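{- Let $f(\mathbf{A}_1,\dots,\mathbf{A}_s)$ be a matrix formula, let $\mathbf{N}$ (of size $n\times n$) and index sets $I,J$ be constructed as described in the context, with $|I|=|J|$, so that $f(\mathbf{A}_1,\dots,\mathbf{A}_s)=\mathbf{I}^{(n)}_{I,[n]}\mathbf{N}^{ -1}\mathbf{I}^{(n)}_{[n],J}$. Let $$\widehat{\mathbf{N}}=\begin{bmatrix}\mathbf{N}&-\mathbf{I}^{(n)}_{[n],J}\\ \mathbf{I}^{(n)}_{I,[n]}&\mathbf{0}\end{bmatrix}.$$ If all inversions within $f(\mathbf{A}_1,\dots,\mathbf{A}_s)$ exist, then $\det(f(\mathbf{A}_1,\dots,\mathbf{A}_s))=\det(\widehat{\mathbf{N}})/\det(\mathbf{N})$.
   Context: A matrix formula is a rooted tree whose leaves (input gates) are the input matrices (each used once) and whose internal nodes are addition, subtraction, multiplication (two children) or inversion (one child). Notation: $\mathbf{I}^{(n)}$ is the $n\times n$ identity; $\mathbf{I}^{(n)}_{[n],J}$ its columns indexed by $J$, $\mathbf{I}^{(n)}_{I,[n]}$ its rows indexed by $I$; $\mathbf{X}_{I,J}$ etc. denote submatrices. $\mathbf{N},I,J$ are defined recursively: (input) leaf $\mathbf{A}\in\mathbb{R}^{n_A\times m_A}$: $\mathbf{N}=\begin{bmatrix}\mathbf{I}^{(n_A)}&\mathbf{A}\\ \mathbf{0}&-\mathbf{I}^{(m_A)}\end{bmatrix}$, $I=\{1,\dots,n_A\}$, $J=\{n_A+1,\dots,n_A+m_A\}$. (inversion) child construction $\mathbf{N}'$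 ($n'\times n'$), sets $I',J'$ of size $n_w$: $\mathbf{N}=\begin{bmatrix}\mathbf{N}'&-\mathbf{I}^{(n')}_{[n'],J'}\\ \mathbf{I}^{(n')}_{I',[n']}&\mathbf{0}\end{bmatrix}$, $I=J=\{n'+1,\dots,n'+n_w\}$. (addition/subtraction) children constructions $\mathbf{L}$ ($n_L\times n_L$; $I_L,J_L$), $\mathbf{R}$ ($n_R\times n_R$; $I_R,J_R$), $|I_L|=|I_R|=n_w$, $|J_L|=|J_R|=m_w$: $\mathbf{N}=\begin{bmatrix}\mathbf{L}&\mathbf{0}&\mathbf{I}^{(n_L)}_{[n_L],J_L}&\mathbf{0}\\ \mathbf{0}&\mathbf{R}&\pm\mathbf{I}^{(n_R)}_{[n_R],J_R}&\mathbf{0}\\ \mathbf{I}^{(n_L)}_{I_L,[n_L]}&\mathbf{I}^{(n_R)}_{I_R,[n_R]}&\mathbf{0}&\mathbf{I}^{(n_w)}\\ \mathbf{0}&\mathbf{0}&\mathbf{I}^{(m_w)}&\mathbf{0}\end{bmatrix}$ ($+$ for addition, $-$ for subtraction; block column widths $n_L,n_R,m_w,n_w$), $I$ = last $n_w$ indices, $J$ = last $m_w$ indices. (multiplication) $\mathbf{N}=\begin{bmatrix}\mathbf{L}&-\mathbf{I}^{(n_L)}_{[n_L],J_L}\mathbf{I}^{(n_R)}_{I_R,[n_R]}\\ \mathbf{0}&\mathbf{R}\end{bmatrix}$, $I=I_L$, $J=\{n_L+j:j\in J_R\}$. When all inversions in the formula are well defined, $\mathbf{N}$ is invertible and $(\mathbf{N}^{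 -1})_{I,J}$ equals the value of the formula. -}

module Defs where

open import Level using (0ℓ)
open import Data.Nat as ℕ using (ℕ; zero; suc)
open import Data.Nat.Properties using (+-comm; +-assoc)
open import Data.Fin as Fin using (Fin; zero; suc; splitAt; _↑ˡ_; _↑ʳ_; punchIn; cast; toℕ; _≟_)
open import Data.Sum using (_⊎_; inj₁; inj₂)
open import Data.Product using (Σ; ∃; _×_; _,_)
open import Relation.Nullary using (¬_; yes; no)
open import Relation.Binary.PropositionalEquality using (_≡_; cong; sym)
open import Algebra.Bundles using (CommutativeRing)

-- The real numbers, given axiomatically as a complete ordered field
-- (all models are isomorphic; the stdlib has no ℝ).

record RealField : Set₁ where
  field
    commutativeRing : CommutativeRing 0ℓ 0ℓ
  open CommutativeRing commutativeRing public
  infix 4 _<_ _≤_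
  field
    0≉1   : ¬ (0# ≈ 1#)
    inv   : (x : Carrier) → ¬ (x ≈ 0#) → Carrier
    inv-r : (x : Carrier) (nz : ¬ (x ≈ 0#)) → x * inv x nz ≈ 1#
    _<_         : Carrier → Carrier → Set
    <-resp-≈    : ∀ {x x' y y'} → x ≈ x' → y ≈ y' → x < y → x' < y'
    <-irrefl    : ∀ {x y} → x ≈ y → ¬ (x < y)
    <-trans     : ∀ {x y z} → x < y → y < z → x < z
    <-trichotomy : ∀ x y → x < y ⊎ (x ≈ y ⊎ y < x)
    +-mono-<    : ∀ {x y} z → x < y → x + z < y + z
    *-pos       : ∀ {x y} → 0# < x → 0# < y → 0# < x * y
  _≤_ : Carrier → Carrier → Set
  x ≤ y = x < y ⊎ x ≈ y
  field
    sup : (P : Carrier → Set) → (∃ λ x → P x) → (∃ λ b → ∀ x → P x → x ≤ b) →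
          ∃ λ s → (∀ x → P x → x ≤ s) × (∀ b → (∀ x → P x → x ≤ b) → s ≤ b)

module Matrices (ℝ : RealField) where
  open RealField ℝ using (Carrier; _≈_; _+_; _*_; _-_; -_; 0#; 1#)

  Matrix : ℕ → ℕ → Set
  Matrix n m = Fin n → Fin m → Carrier

  _≈M_ : ∀ {n m} → Matrix n m → Matrix n m → Set
  A ≈M B = ∀ i j → A i j ≈ B i j

  sumF : ∀ n → (Fin n → Carrier) → Carrier
  sumF zero    f = 0#
  sumF (suc n) f = f zero + sumF n (λ i → f (suc i))

  𝟎 : ∀ {n m} → Matrix n m
  𝟎 _ _ = 0#

  𝐈 : ∀ n → Matrix n n
  𝐈 n i j with i ≟ j
  ... | yes _ = 1#
  ... | no  _ = 0#

  _+M_ : ∀ {n m} → Matrix n m → Matrix n m → Matrix n m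
  (A +M B) i j = A i j + B i j

  _-M_ : ∀ {n m} → Matrix n m → Matrix n m → Matrix n m
  (A -M B) i j = A i j - B i j

  -M_ : ∀ {n m} → Matrix n m → Matrix n m
  (-M A) i j = - A i j

  _*M_ : ∀ {n k m} → Matrix n k → Matrix k m → Matrix n m
  _*M_ {k = k} A B i j = sumF k (λ l → A i l * B l j)

  -- I^(N)_{I,[N]} : rows of the identity indexed by the (ordered) index map I
  rowSel : ∀ {a N} → (Fin a → Fin N) → Matrix a N
  rowSel {N = N} I i k = 𝐈 N (I i) k

  -- I^(N)_{[N],J} : columns of the identity indexed by J
  colSel : ∀ {a N} → (Fin a → Fin N) → Matrix N a
  colSel {N = N} J k j = 𝐈 N k (J j)

  hcat : ∀ {a c d} → Matrix a c → Matrix a d → Matrix a (c ℕ.+ d)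
  hcat {c = c} P Q i j with splitAt c j
  ... | inj₁ j' = P i j'
  ... | inj₂ j' = Q i j'

  vcat : ∀ {a b c} → Matrix a c → Matrix b c → Matrix (a ℕ.+ b) c
  vcat {a = a} P S i j with splitAt a i
  ... | inj₁ i' = P i' j
  ... | inj₂ i' = S i' j

  blocks : ∀ {a b c d} → Matrix a c → Matrix a d → Matrix b c → Matrix b d →
           Matrix (a ℕ.+ b) (c ℕ.+ d)
  blocks P Q S T = vcat (hcat P Q) (hcat S T)

  signed : ℕ → Carrier → Carrier
  signed zero    x = x
  signed (suc k) x = - signed k x

  det : ∀ {n} → Matrix n n → Carrier
  det {zero}  M = 1#
  det {suc n} M = sumF (suc n) (λ j → signed (toℕ j) (M zero j * det (λ a b → M (suc a) (punchIn j b))))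

  -- matrix formulas, indexed by the dimensions of their value;
  -- each leaf carries its own input matrix (so each input is used once)
  data Formula : ℕ → ℕ → Set where
    input : ∀ {n m} → Matrix n m → Formula n m
    inv′  : ∀ {n} → Formula n n → Formula n n
    add   : ∀ {n m} → Formula n m → Formula n m → Formula n m
    sub   : ∀ {n m} → Formula n m → Formula n m → Formula n m
    mul   : ∀ {n k m} → Formula n k → Formula k m → Formula n m

  -- Eval f V : all inversions in f exist and f evaluates to V
  data Eval : ∀ {n m} → Formula n m → Matrix n m → Set where
    ev-input : ∀ {n m} (A : Matrix n m) → Eval (input A) A
    ev-inv   : ∀ {n} {f : Formula n n} {X V : Matrix n n} → Eval f X →
               (X *M V) ≈M 𝐈 n → (V *M X) ≈M 𝐈 n → Eval (inv′ f) V
    ev-add   : ∀ {n m} {f g : Formula n m} {X Y} → Eval f X → Eval g Y → Eval (add f g) (X +M Y)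
    ev-sub   : ∀ {n m} {f g : Formula n m} {X Y} → Eval f X → Eval g Y → Eval (sub f g) (X -M Y)
    ev-mul   : ∀ {n k m} {f : Formula n k} {g : Formula k m} {X Y} → Eval f X → Eval g Y →
               Eval (mul f g) (X *M Y)

  -- the construction (N, I, J); I, J are index maps listing the index sets in increasing order
  record Construction (n m : ℕ) : Set where
    field
      size : ℕ
      N    : Matrix size size
      I    : Fin n → Fin size
      J    : Fin m → Fin size

  castCols : ∀ {r c c'} → c ≡ c' → Matrix r c → Matrix r c'
  castCols eq M i j = M i (cast (sym eq) j)

  addSub : ∀ {n m} → (Carrier → Carrier) → Construction n m → Construction n m → Construction n m
  addSub {n} {m} sgn CL CR = record
    { size = s
    ; N    = castCols eq
               (vcat (hcat L (hcat (𝟎 {nL} {nR}) (hcat (colSel JL) (𝟎 {nL} {n}))))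
               (vcat (hcat (𝟎 {nR} {nL}) (hcat R (hcat (λ i j → sgn (colSel JR i j)) (𝟎 {nR} {n}))))
               (vcat (hcat (rowSel IL) (hcat (rowSel IR) (hcat (𝟎 {n} {m}) (𝐈 n))))
                     (hcat (𝟎 {m} {nL}) (hcat (𝟎 {m} {nR}) (hcat (𝐈 m) (𝟎 {m} {n})))))))
    ; I    = λ i → cast eq (nL ↑ʳ (nR ↑ʳ (m ↑ʳ i)))
    ; J    = λ j → nL ↑ʳ (nR ↑ʳ (n ↑ʳ j))
    }
    where
      open Construction CL renaming (size to nL; N to L; I to IL; J to JL)
      open Construction CR renaming (size to nR; N to R; I to IR; J to JR)
      s = nL ℕ.+ (nR ℕ.+ (n ℕ.+ m))
      eq : nL ℕ.+ (nR ℕ.+ (m ℕ.+ n)) ≡ s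
      eq = cong (λ x → nL ℕ.+ (nR ℕ.+ x)) (+-comm m n)

  construct : ∀ {n m} → Formula n m → Construction n m
  construct {n} {m} (input A) = record
    { size = n ℕ.+ m
    ; N    = blocks (𝐈 n) A 𝟎 (-M 𝐈 m)
    ; I    = λ i → i ↑ˡ m
    ; J    = λ j → n ↑ʳ j
    }
  construct {n} (inv′ f) = record
    { size = s′ ℕ.+ n
    ; N    = blocks N′ (-M colSel J′) (rowSel I′) 𝟎
    ; I    = λ i → s′ ↑ʳ i
    ; J    = λ j → s′ ↑ʳ j
    }
    where open Construction (construct f) renaming (size to s′; N to N′; I to I′; J to J′)
  construct (add f g) = addSub (λ x → x) (construct f) (construct g)
  construct (sub f g) = addSub -_ (construct f) (construct g)
  construct (mul f g) = record
    { size = sL ℕ.+ sR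
    ; N    = blocks L (-M (colSel JL *M rowSel IR)) 𝟎 R
    ; I    = λ i → IL i ↑ˡ sR
    ; J    = λ j → sL ↑ʳ JR j
    }
    where
      open Construction (construct f) renaming (size to sL; N to L; I to IL; J to JL)
      open Construction (construct g) renaming (size to sR; N to R; I to IR; J to JR)

  N̂ : ∀ {n} (C : Construction n n) → Matrix (Construction.size C ℕ.+ n) (Construction.size C ℕ.+ n)
  N̂ C = blocks (Construction.N C) (-M colSel (Construction.J C)) (rowSel (Construction.I C)) 𝟎

{-# OPTIONS --safe #-}
-- The construction N has an explicit right inverse N⁻¹ whose (I, J)-block is the value V of the
-- formula.  In every case N is a block matrix [[D, P], [Q, K]], and N⁻¹ is assembled from right
-- inverses of D and of the Schur complement K − Q D⁻¹ P; for addition and subtraction this is done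
-- twice, ending with [[−T, 𝐈], [𝐈, 0]] where T = X ± Y.
--
-- Column operations show det [[A, B], [C, D]] = det A · det (D − C Z) whenever A Z = B.  With A = N
-- and Z = −N⁻¹ 𝐈_{[n],J} this is det N̂ = det N · det V.  Applied to [[N, −𝐈], [𝐈, 0]], whose
-- determinant is 1, it gives det N · det N⁻¹ = 1, hence det N ≠ 0.  Since det is given only by the
-- Laplace expansion along the first row, its multilinearity and alternation in the columns are
-- derived from that expansion.  Apart from 0 ≠ 1 and the final division, only the commutative-ring
-- structure of ℝ is used.

module Submission where

open import Defs
open import Data.Nat using (ℕ)
open import Data.Product using (Σ)
open import Relation.Nullary using (¬_)

open import Data.Nat as ℕ using (zero; suc)
import Data.Nat.Properties as ℕₚ
open import Data.Fin as Fin using (Fin; zero; suc; splitAt; join; _↑ˡ_; _↑ʳ_; punchIn; punchOut; cast; toℕ; _≟_)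
import Data.Fin.Properties as Fin
open import Data.Sum as Sum using (_⊎_; inj₁; inj₂)
open import Data.Product as Product using (_×_; _,_)
open import Data.Bool using (Bool; true; false; not)
import Data.Bool.Properties as Bool
open import Data.Empty using (⊥-elim)
open import Function using (_∘_; id)
open import Relation.Nullary using (Dec; yes; no)
open import Relation.Binary.Bundles using (Setoid)
open import Relation.Binary.Definitions using (tri<; tri≈; tri>)
open import Relation.Binary.PropositionalEquality as ≡ using (_≡_; _≢_)
import Relation.Binary.Reasoning.Setoid as SetoidReasoning

module _ (ℝ : RealField) where
  open RealField ℝ hiding (zero)
  open Matrices ℝ
  open import Algebra.Properties.Ring ring
    using (-0#≈0#; -‿involutive; -‿distribˡ-*; -‿distribʳ-*; -‿+-comm; +-inverseʳ-unique; -1*x≈-x)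
  open import Algebra.Properties.CommutativeSemigroup +-commutativeSemigroup
    using () renaming (interchange to +-interchange; x∙yz≈y∙xz to x+[y+z]≈y+[x+z])
  open import Algebra.Properties.CommutativeSemigroup *-commutativeSemigroup using (x∙yz≈y∙xz)
  module ≈-Reasoning = SetoidReasoning setoid

  x+y-y≈x : ∀ x y → x + y - y ≈ x
  x+y-y≈x x y = trans (+-assoc x y (- y)) (trans (+-congˡ (-‿inverseʳ y)) (+-identityʳ x))

  x≈0∧y≈0⇒x+y≈0 : ∀ {x y} → x ≈ 0# → y ≈ 0# → x + y ≈ 0#
  x≈0∧y≈0⇒x+y≈0 x≈0 y≈0 = trans (+-cong x≈0 y≈0) (+-identityʳ 0#)

  x+y-z≈0 : ∀ {x y z} → z - y ≈ x → x + y - z ≈ 0#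
  x+y-z≈0 {x} {y} {z} z-y≈x = begin
    x + y - z          ≈⟨ +-assoc x y (- z) ⟩
    x + (y - z)        ≈⟨ +-congˡ (+-comm y (- z)) ⟩
    x + (- z + y)      ≈⟨ +-congˡ (+-congˡ (-‿involutive y)) ⟨
    x + (- z + - - y)  ≈⟨ +-congˡ (-‿+-comm z (- y)) ⟩
    x - (z - y)        ≈⟨ +-congˡ (-‿cong z-y≈x) ⟩
    x - x              ≈⟨ -‿inverseʳ x ⟩
    0#                 ∎
    where open ≈-Reasoning

  sumF-cong : ∀ n {f g : Fin n → Carrier} → (∀ i → f i ≈ g i) → sumF n f ≈ sumF n g
  sumF-cong zero    f≈g = refl
  sumF-cong (suc n) f≈g = +-cong (f≈g zero) (sumF-cong n (f≈g ∘ suc))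

  sumF-zero : ∀ n {f : Fin n → Carrier} → (∀ i → f i ≈ 0#) → sumF n f ≈ 0#
  sumF-zero zero    f≈0 = refl
  sumF-zero (suc n) f≈0 = x≈0∧y≈0⇒x+y≈0 (f≈0 zero) (sumF-zero n (f≈0 ∘ suc))

  sumF-distrib-+ : ∀ n (f g : Fin n → Carrier) → sumF n (λ i → f i + g i) ≈ sumF n f + sumF n g
  sumF-distrib-+ zero    f g = sym (+-identityʳ 0#)
  sumF-distrib-+ (suc n) f g = trans (+-congˡ (sumF-distrib-+ n (f ∘ suc) (g ∘ suc))) (+-interchange _ _ _ _)

  *-distribˡ-sumF : ∀ n x (f : Fin n → Carrier) → x * sumF n f ≈ sumF n (λ i → x * f i)
  *-distribˡ-sumF zero    x f = zeroʳ x
  *-distribˡ-sumF (suc n) x f = trans (distribˡ x _ _) (+-congˡ (*-distribˡ-sumF n x (f ∘ suc)))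

  *-distribʳ-sumF : ∀ n x (f : Fin n → Carrier) → sumF n f * x ≈ sumF n (λ i → f i * x)
  *-distribʳ-sumF zero    x f = zeroˡ x
  *-distribʳ-sumF (suc n) x f = trans (distribʳ x _ _) (+-congˡ (*-distribʳ-sumF n x (f ∘ suc)))

  -‿distrib-sumF : ∀ n (f : Fin n → Carrier) → - sumF n f ≈ sumF n (λ i → - f i)
  -‿distrib-sumF zero    f = -0#≈0#
  -‿distrib-sumF (suc n) f = trans (sym (-‿+-comm _ _)) (+-congˡ (-‿distrib-sumF n (f ∘ suc)))

  sumF-splitAt : ∀ a b (f : Fin (a ℕ.+ b) → Carrier) →
    sumF (a ℕ.+ b) f ≈ sumF a (λ i → f (i ↑ˡ b)) + sumF b (λ i → f (a ↑ʳ i))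
  sumF-splitAt zero    b f = sym (+-identityˡ _)
  sumF-splitAt (suc a) b f = trans (+-congˡ (sumF-splitAt a b (f ∘ suc))) (sym (+-assoc _ _ _))

  sumF-comm : ∀ n m (f : Fin n → Fin m → Carrier) →
    sumF n (λ i → sumF m (f i)) ≈ sumF m (λ j → sumF n (λ i → f i j))
  sumF-comm zero    m f = sym (sumF-zero m (λ _ → refl))
  sumF-comm (suc n) m f = trans (+-congˡ (sumF-comm n m (f ∘ suc))) (sym (sumF-distrib-+ m _ _))

  sumF-remove : ∀ n (f : Fin (suc n) → Carrier) p → sumF (suc n) f ≈ f p + sumF n (f ∘ punchIn p)
  sumF-remove n       f zero    = refl
  sumF-remove (suc n) f (suc p) =
    trans (+-congˡ (sumF-remove n (f ∘ suc) p)) (x+[y+z]≈y+[x+z] _ _ _)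

  sumF-single : ∀ n (f : Fin n → Carrier) p → (∀ i → i ≢ p → f i ≈ 0#) → sumF n f ≈ f p
  sumF-single (suc n) f p others≈0 = begin
    sumF (suc n) f                   ≈⟨ sumF-remove n f p ⟩
    f p + sumF n (f ∘ punchIn p)     ≈⟨ +-congˡ (sumF-zero n (λ i → others≈0 _ (Fin.punchInᵢ≢i p i))) ⟩
    f p + 0#                         ≈⟨ +-identityʳ _ ⟩
    f p                              ∎
    where open ≈-Reasoning

  sumF-pair : ∀ n (f : Fin n → Carrier) p q → p ≢ q → (∀ j → j ≢ p → j ≢ q → f j ≈ 0#) →
    sumF n f ≈ f p + f q
  sumF-pair (suc n) f p q p≢q others≈0 = begin
    sumF (suc n) f                  ≈⟨ sumF-remove n f p ⟩
    f p + sumF n (f ∘ punchIn p)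
      ≈⟨ +-congˡ (sumF-single n _ q′ (λ i i≢q′ → others≈0 _ (Fin.punchInᵢ≢i p i) (i≢q′ ∘ punchIn≡q⇒≡q′ i))) ⟩
    f p + f (punchIn p q′)          ≈⟨ +-congˡ (reflexive (≡.cong f (Fin.punchIn-punchOut p≢q))) ⟩
    f p + f q                       ∎
    where
    open ≈-Reasoning
    q′ = punchOut p≢q
    punchIn≡q⇒≡q′ : ∀ i → punchIn p i ≡ q → i ≡ q′
    punchIn≡q⇒≡q′ i e = Fin.punchIn-injective p i q′ (≡.trans e (≡.sym (Fin.punchIn-punchOut p≢q)))

  -- Matrix algebra

  𝐈-diag : ∀ n i → 𝐈 n i i ≈ 1#
  𝐈-diag n i with i ≟ i
  ... | yes _ = refl
  ... | no i≢i = ⊥-elim (i≢i ≡.refl)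

  𝐈-offDiag : ∀ n {i j} → i ≢ j → 𝐈 n i j ≈ 0#
  𝐈-offDiag n {i} {j} i≢j with i ≟ j
  ... | yes i≡j = ⊥-elim (i≢j i≡j)
  ... | no _ = refl

  𝐈-reindex : ∀ {m n} (f : Fin m → Fin n) → (∀ {i j} → f i ≡ f j → i ≡ j) → ∀ i j → 𝐈 n (f i) (f j) ≈ 𝐈 m i j
  𝐈-reindex {m} {n} f f-injective i j with i ≟ j
  ... | yes ≡.refl = 𝐈-diag n (f i)
  ... | no i≢j = 𝐈-offDiag n (i≢j ∘ f-injective)

  𝐈-sym : ∀ n i j → 𝐈 n i j ≈ 𝐈 n j i
  𝐈-sym n i j with i ≟ j
  ... | yes ≡.refl = sym (𝐈-diag n i)
  ... | no i≢j = sym (𝐈-offDiag n (i≢j ∘ ≡.sym))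

  sumF-𝐈ˡ : ∀ n i (f : Fin n → Carrier) → sumF n (λ l → 𝐈 n i l * f l) ≈ f i
  sumF-𝐈ˡ n i f = trans (sumF-single n _ i (λ l l≢i → trans (*-congʳ (𝐈-offDiag n (l≢i ∘ ≡.sym))) (zeroˡ _)))
                        (trans (*-congʳ (𝐈-diag n i)) (*-identityˡ _))

  sumF-𝐈ʳ : ∀ n j (f : Fin n → Carrier) → sumF n (λ l → f l * 𝐈 n l j) ≈ f j
  sumF-𝐈ʳ n j f = trans (sumF-cong n (λ l → trans (*-comm _ _) (*-congʳ (𝐈-sym n l j)))) (sumF-𝐈ˡ n j f)

  ≈M-setoid : ℕ → ℕ → Setoid _ _
  ≈M-setoid n m = record
    { Carrier       = Matrix n m
    ; _≈_           = _≈M_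
    ; isEquivalence = record
      { refl  = λ _ _ → refl
      ; sym   = λ A≈B i j → sym (A≈B i j)
      ; trans = λ A≈B B≈C i j → trans (A≈B i j) (B≈C i j)
      }
    }

  module ≈M-Reasoning {n m} = SetoidReasoning (≈M-setoid n m)
  open module ≈M {n m} = Setoid (≈M-setoid n m) using ()
    renaming (refl to ≈M-refl; sym to ≈M-sym; trans to ≈M-trans)

  *M-cong : ∀ {n k m} {A A′ : Matrix n k} {B B′ : Matrix k m} → A ≈M A′ → B ≈M B′ → (A *M B) ≈M (A′ *M B′)
  *M-cong {k = k} A≈A′ B≈B′ i j = sumF-cong k (λ l → *-cong (A≈A′ i l) (B≈B′ l j))

  *M-congˡ : ∀ {n k m} (A : Matrix n k) {B B′ : Matrix k m} → B ≈M B′ → (A *M B) ≈M (A *M B′)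
  *M-congˡ A = *M-cong (≈M-refl {x = A})

  *M-congʳ : ∀ {n k m} {A A′ : Matrix n k} (B : Matrix k m) → A ≈M A′ → (A *M B) ≈M (A′ *M B)
  *M-congʳ B A≈A′ = *M-cong A≈A′ (≈M-refl {x = B})

  *M-assoc : ∀ {n k l m} (A : Matrix n k) (B : Matrix k l) (C : Matrix l m) →
    ((A *M B) *M C) ≈M (A *M (B *M C))
  *M-assoc {k = k} {l = l} A B C i j = begin
    sumF l (λ x → sumF k (λ y → A i y * B y x) * C x j) ≈⟨ sumF-cong l (λ x → *-distribʳ-sumF k _ _) ⟩
    sumF l (λ x → sumF k (λ y → A i y * B y x * C x j)) ≈⟨ sumF-comm l k _ ⟩
    sumF k (λ y → sumF l (λ x → A i y * B y x * C x j)) ≈⟨ sumF-cong k (λ y → sumF-cong l (λ x → *-assoc _ _ _)) ⟩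
    sumF k (λ y → sumF l (λ x → A i y * (B y x * C x j))) ≈⟨ sumF-cong k (λ y → *-distribˡ-sumF l _ _) ⟨
    sumF k (λ y → A i y * sumF l (λ x → B y x * C x j)) ∎
    where open ≈-Reasoning

  *M-identityˡ : ∀ {n m} (A : Matrix n m) → (𝐈 n *M A) ≈M A
  *M-identityˡ {n} A i j = sumF-𝐈ˡ n i (λ l → A l j)

  *M-identityʳ : ∀ {n m} (A : Matrix n m) → (A *M 𝐈 m) ≈M A
  *M-identityʳ {m = m} A i j = sumF-𝐈ʳ m j (A i)

  *M-zeroˡ : ∀ {n k m} (B : Matrix k m) → (𝟎 {n} {k} *M B) ≈M 𝟎
  *M-zeroˡ {k = k} B i j = sumF-zero k (λ l → zeroˡ _)

  *M-zeroʳ : ∀ {n k m} (A : Matrix n k) → (A *M 𝟎 {k} {m}) ≈M 𝟎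
  *M-zeroʳ {k = k} A i j = sumF-zero k (λ l → zeroʳ _)

  *M-distribˡ-+M : ∀ {n k m} (A : Matrix n k) (B C : Matrix k m) → (A *M (B +M C)) ≈M ((A *M B) +M (A *M C))
  *M-distribˡ-+M {k = k} A B C i j = trans (sumF-cong k (λ l → distribˡ _ _ _)) (sumF-distrib-+ k _ _)

  *M-distribʳ-+M : ∀ {n k m} (A B : Matrix n k) (C : Matrix k m) → ((A +M B) *M C) ≈M ((A *M C) +M (B *M C))
  *M-distribʳ-+M {k = k} A B C i j = trans (sumF-cong k (λ l → distribʳ _ _ _)) (sumF-distrib-+ k _ _)

  *M-negˡ : ∀ {n k m} (A : Matrix n k) (B : Matrix k m) → ((-M A) *M B) ≈M (-M (A *M B))
  *M-negˡ {k = k} A B i j = trans (sumF-cong k (λ l → sym (-‿distribˡ-* _ _))) (sym (-‿distrib-sumF k _))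

  *M-negʳ : ∀ {n k m} (A : Matrix n k) (B : Matrix k m) → (A *M (-M B)) ≈M (-M (A *M B))
  *M-negʳ {k = k} A B i j = trans (sumF-cong k (λ l → sym (-‿distribʳ-* _ _))) (sym (-‿distrib-sumF k _))

  *M-distribʳ--M : ∀ {n k m} (A B : Matrix n k) (C : Matrix k m) → ((A -M B) *M C) ≈M ((A *M C) -M (B *M C))
  *M-distribʳ--M A B C i j = trans (*M-distribʳ-+M A (-M B) C i j) (+-congˡ (*M-negˡ B C i j))

  *M-cancelˡ : ∀ {n n′ m} {A : Matrix n n′} {A⁻¹ : Matrix n′ n} (B : Matrix n m) →
    (A *M A⁻¹) ≈M 𝐈 n → (A *M (A⁻¹ *M B)) ≈M B
  *M-cancelˡ {A = A} {A⁻¹} B AA⁻¹≈𝐈 = begin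
    A *M (A⁻¹ *M B)  ≈⟨ *M-assoc A A⁻¹ B ⟨
    (A *M A⁻¹) *M B  ≈⟨ *M-congʳ B AA⁻¹≈𝐈 ⟩
    𝐈 _ *M B         ≈⟨ *M-identityˡ B ⟩
    B                ∎
    where open ≈M-Reasoning

  rowSel-*M : ∀ {a n m} (I : Fin a → Fin n) (A : Matrix n m) i j → (rowSel I *M A) i j ≈ A (I i) j
  rowSel-*M {n = n} I A i j = sumF-𝐈ˡ n (I i) (λ l → A l j)

  *M-colSel : ∀ {a n m} (J : Fin a → Fin n) (A : Matrix m n) i j → (A *M colSel J) i j ≈ A i (J j)
  *M-colSel {n = n} J A i j = sumF-𝐈ʳ n (J j) (A i)

  -M-congʳ : ∀ {n m} (A : Matrix n m) {B B′ : Matrix n m} → B ≈M B′ → (A -M B) ≈M (A -M B′)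
  -M-congʳ A B≈B′ i j = +-congˡ (-‿cong (B≈B′ i j))

  -M-zeroʳ : ∀ {n m} (A : Matrix n m) {B : Matrix n m} → B ≈M 𝟎 → (A -M B) ≈M A
  -M-zeroʳ A B≈𝟎 i j = trans (+-congˡ (trans (-‿cong (B≈𝟎 i j)) -0#≈0#)) (+-identityʳ _)

  -𝐈*-𝐈≈𝐈 : ∀ n → ((-M 𝐈 n) *M (-M 𝐈 n)) ≈M 𝐈 n
  -𝐈*-𝐈≈𝐈 n i j = trans (*M-negˡ (𝐈 n) (-M 𝐈 n) i j)
                   (trans (-‿cong (*M-identityˡ (-M 𝐈 n) i j)) (-‿involutive _))

  castCols-*M-castRows : ∀ {n k k′ m} (eq : k ≡ k′) (A : Matrix n k) (B : Matrix k m) →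
    (castCols eq A *M (λ c j → B (cast (≡.sym eq) c) j)) ≈M (A *M B)
  castCols-*M-castRows {k = k} ≡.refl A B i j =
    sumF-cong k (λ c → reflexive (≡.cong (λ c′ → A i c′ * B c′ j) (Fin.cast-is-id ≡.refl c)))

  -- Block matrices

  ↑-elim : ∀ {a b} (P : Fin (a ℕ.+ b) → Set) → (∀ i → P (i ↑ˡ b)) → (∀ i → P (a ↑ʳ i)) → ∀ k → P k
  ↑-elim {a} {b} P left right k =
    ≡.subst P (Fin.join-splitAt a b k) (Sum.[_,_] {C = P ∘ join a b} left right (splitAt a k))

  ↑ˡ≢↑ʳ : ∀ {a b} (i : Fin a) (j : Fin b) → i ↑ˡ b ≢ a ↑ʳ j
  ↑ˡ≢↑ʳ {a} {b} i j eq
    with ≡.trans (≡.sym (Fin.splitAt-↑ˡ a i b)) (≡.trans (≡.cong (splitAt a) eq) (Fin.splitAt-↑ʳ a b j))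
  ... | ()

  hcat-↑ˡ : ∀ {a c d} (A : Matrix a c) (B : Matrix a d) i j → hcat A B i (j ↑ˡ d) ≡ A i j
  hcat-↑ˡ {c = c} {d} A B i j rewrite Fin.splitAt-↑ˡ c j d = ≡.refl

  hcat-↑ʳ : ∀ {a c d} (A : Matrix a c) (B : Matrix a d) i j → hcat A B i (c ↑ʳ j) ≡ B i j
  hcat-↑ʳ {c = c} {d} A B i j rewrite Fin.splitAt-↑ʳ c d j = ≡.refl

  vcat-↑ˡ : ∀ {a b c} (A : Matrix a c) (B : Matrix b c) i j → vcat A B (i ↑ˡ b) j ≡ A i j
  vcat-↑ˡ {a} {b} A B i j rewrite Fin.splitAt-↑ˡ a i b = ≡.refl

  vcat-↑ʳ : ∀ {a b c} (A : Matrix a c) (B : Matrix b c) i j → vcat A B (a ↑ʳ i) j ≡ B i j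
  vcat-↑ʳ {a} {b} A B i j rewrite Fin.splitAt-↑ʳ a b i = ≡.refl

  blocks-↑ˡ-↑ˡ : ∀ {a b c d} (A : Matrix a c) (B : Matrix a d) (C : Matrix b c) (D : Matrix b d) i j →
    blocks A B C D (i ↑ˡ b) (j ↑ˡ d) ≡ A i j
  blocks-↑ˡ-↑ˡ A B C D i j = ≡.trans (vcat-↑ˡ (hcat A B) (hcat C D) i _) (hcat-↑ˡ A B i j)

  blocks-↑ˡ-↑ʳ : ∀ {a b c d} (A : Matrix a c) (B : Matrix a d) (C : Matrix b c) (D : Matrix b d) i j →
    blocks A B C D (i ↑ˡ b) (c ↑ʳ j) ≡ B i j
  blocks-↑ˡ-↑ʳ A B C D i j = ≡.trans (vcat-↑ˡ (hcat A B) (hcat C D) i _) (hcat-↑ʳ A B i j)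

  blocks-↑ʳ-↑ˡ : ∀ {a b c d} (A : Matrix a c) (B : Matrix a d) (C : Matrix b c) (D : Matrix b d) i j →
    blocks A B C D (a ↑ʳ i) (j ↑ˡ d) ≡ C i j
  blocks-↑ʳ-↑ˡ A B C D i j = ≡.trans (vcat-↑ʳ (hcat A B) (hcat C D) i _) (hcat-↑ˡ C D i j)

  blocks-↑ʳ-↑ʳ : ∀ {a b c d} (A : Matrix a c) (B : Matrix a d) (C : Matrix b c) (D : Matrix b d) i j →
    blocks A B C D (a ↑ʳ i) (c ↑ʳ j) ≡ D i j
  blocks-↑ʳ-↑ʳ A B C D i j = ≡.trans (vcat-↑ʳ (hcat A B) (hcat C D) i _) (hcat-↑ʳ C D i j)

  hcat-cong : ∀ {a c d} {A A′ : Matrix a c} {B B′ : Matrix a d} → A ≈M A′ → B ≈M B′ → hcat A B ≈M hcat A′ B′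
  hcat-cong {c = c} A≈A′ B≈B′ i j with splitAt c j
  ... | inj₁ j′ = A≈A′ i j′
  ... | inj₂ j′ = B≈B′ i j′

  vcat-cong : ∀ {a b c} {A A′ : Matrix a c} {B B′ : Matrix b c} → A ≈M A′ → B ≈M B′ → vcat A B ≈M vcat A′ B′
  vcat-cong {a} A≈A′ B≈B′ i j with splitAt a i
  ... | inj₁ i′ = A≈A′ i′ j
  ... | inj₂ i′ = B≈B′ i′ j

  blocks-cong : ∀ {a b c d} {A A′ : Matrix a c} {B B′ : Matrix a d} {C C′ : Matrix b c} {D D′ : Matrix b d} →
    A ≈M A′ → B ≈M B′ → C ≈M C′ → D ≈M D′ → blocks A B C D ≈M blocks A′ B′ C′ D′
  blocks-cong A≈A′ B≈B′ C≈C′ D≈D′ = vcat-cong (hcat-cong A≈A′ B≈B′) (hcat-cong C≈C′ D≈D′)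

  vcat-*M : ∀ {a b k m} (A : Matrix a k) (B : Matrix b k) (C : Matrix k m) →
    (vcat A B *M C) ≈M vcat (A *M C) (B *M C)
  vcat-*M {a} A B C i j with splitAt a i
  ... | inj₁ _ = refl
  ... | inj₂ _ = refl

  *M-hcat : ∀ {n k c d} (A : Matrix n k) (B : Matrix k c) (C : Matrix k d) →
    (A *M hcat B C) ≈M hcat (A *M B) (A *M C)
  *M-hcat {c = c} A B C i j with splitAt c j
  ... | inj₁ _ = refl
  ... | inj₂ _ = refl

  hcat-*M-vcat : ∀ {n c d m} (A : Matrix n c) (B : Matrix n d) (C : Matrix c m) (D : Matrix d m) →
    (hcat A B *M vcat C D) ≈M ((A *M C) +M (B *M D))
  hcat-*M-vcat {c = c} {d} A B C D i j = trans (sumF-splitAt c d _)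
    (+-cong (sumF-cong c (λ l → reflexive (≡.cong₂ _*_ (hcat-↑ˡ A B i l) (vcat-↑ˡ C D l j))))
            (sumF-cong d (λ l → reflexive (≡.cong₂ _*_ (hcat-↑ʳ A B i l) (vcat-↑ʳ C D l j)))))

  hcat-+M : ∀ {a c d} (A C : Matrix a c) (B D : Matrix a d) → (hcat A B +M hcat C D) ≈M hcat (A +M C) (B +M D)
  hcat-+M {c = c} A C B D i j with splitAt c j
  ... | inj₁ _ = refl
  ... | inj₂ _ = refl

  vcat-+M : ∀ {a b c} (A C : Matrix a c) (B D : Matrix b c) → (vcat A B +M vcat C D) ≈M vcat (A +M C) (B +M D)
  vcat-+M {a} A C B D i j with splitAt a i
  ... | inj₁ _ = refl
  ... | inj₂ _ = refl

  blocks-*M : ∀ {a b c d m o} (A : Matrix a c) (B : Matrix a d) (C : Matrix b c) (D : Matrix b d)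
    (E : Matrix c m) (F : Matrix c o) (G : Matrix d m) (H : Matrix d o) →
    (blocks A B C D *M blocks E F G H) ≈M
      blocks ((A *M E) +M (B *M G)) ((A *M F) +M (B *M H)) ((C *M E) +M (D *M G)) ((C *M F) +M (D *M H))
  blocks-*M {m = m} A B C D E F G H =
    ≈M-trans (vcat-*M (hcat A B) (hcat C D) _) (vcat-cong (rowBlock A B) (rowBlock C D))
    where
    rowBlock : ∀ {r} (X : Matrix r _) (Y : Matrix r _) →
      (hcat X Y *M blocks E F G H) ≈M hcat ((X *M E) +M (Y *M G)) ((X *M F) +M (Y *M H))
    rowBlock X Y = ≈M-trans (hcat-*M-vcat X Y (hcat E F) (hcat G H))
      (≈M-trans (λ i j → +-cong (*M-hcat X E F i j) (*M-hcat Y G H i j)) (hcat-+M {c = m} _ _ _ _))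

  blocks-+M : ∀ {a b c d} (A E : Matrix a c) (B F : Matrix a d) (C G : Matrix b c) (D H : Matrix b d) →
    (blocks A B C D +M blocks E F G H) ≈M blocks (A +M E) (B +M F) (C +M G) (D +M H)
  blocks-+M {c = c} A E B F C G D H =
    ≈M-trans (vcat-+M (hcat A B) (hcat E F) _ _) (vcat-cong (hcat-+M {c = c} A E B F) (hcat-+M {c = c} C G D H))

  ≈M-blocks : ∀ {a b c d} {M : Matrix (a ℕ.+ b) (c ℕ.+ d)}
    {A : Matrix a c} {B : Matrix a d} {C : Matrix b c} {D : Matrix b d} →
    (∀ i j → M (i ↑ˡ b) (j ↑ˡ d) ≈ A i j) → (∀ i j → M (i ↑ˡ b) (c ↑ʳ j) ≈ B i j) →
    (∀ i j → M (a ↑ʳ i) (j ↑ˡ d) ≈ C i j) → (∀ i j → M (a ↑ʳ i) (c ↑ʳ j) ≈ D i j) →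
    M ≈M blocks A B C D
  ≈M-blocks {M = M} {A} {B} {C} {D} M≈A M≈B M≈C M≈D = ↑-elim _
    (λ i → ↑-elim _ (λ j → trans (M≈A i j) (reflexive (≡.sym (blocks-↑ˡ-↑ˡ A B C D i j))))
                    (λ j → trans (M≈B i j) (reflexive (≡.sym (blocks-↑ˡ-↑ʳ A B C D i j)))))
    (λ i → ↑-elim _ (λ j → trans (M≈C i j) (reflexive (≡.sym (blocks-↑ʳ-↑ˡ A B C D i j))))
                    (λ j → trans (M≈D i j) (reflexive (≡.sym (blocks-↑ʳ-↑ʳ A B C D i j)))))

  blocks--M : ∀ {a b c d} (A E : Matrix a c) (B F : Matrix a d) (C G : Matrix b c) (D H : Matrix b d) →
    (blocks A B C D -M blocks E F G H) ≈M blocks (A -M E) (B -M F) (C -M G) (D -M H)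
  blocks--M A E B F C G D H = ≈M-blocks
    (λ i j → reflexive (≡.cong₂ _-_ (blocks-↑ˡ-↑ˡ A B C D i j) (blocks-↑ˡ-↑ˡ E F G H i j)))
    (λ i j → reflexive (≡.cong₂ _-_ (blocks-↑ˡ-↑ʳ A B C D i j) (blocks-↑ˡ-↑ʳ E F G H i j)))
    (λ i j → reflexive (≡.cong₂ _-_ (blocks-↑ʳ-↑ˡ A B C D i j) (blocks-↑ʳ-↑ˡ E F G H i j)))
    (λ i j → reflexive (≡.cong₂ _-_ (blocks-↑ʳ-↑ʳ A B C D i j) (blocks-↑ʳ-↑ʳ E F G H i j)))

  𝐈-blocks : ∀ a b → 𝐈 (a ℕ.+ b) ≈M blocks (𝐈 a) 𝟎 𝟎 (𝐈 b)
  𝐈-blocks a b = ≈M-blocks (𝐈-reindex (_↑ˡ b) (Fin.↑ˡ-injective b _ _))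
                           (λ i j → 𝐈-offDiag _ (↑ˡ≢↑ʳ i j))
                           (λ i j → 𝐈-offDiag _ (↑ˡ≢↑ʳ j i ∘ ≡.sym))
                           (𝐈-reindex (a ↑ʳ_) (Fin.↑ʳ-injective a _ _))

  hcat-vcat-interchange : ∀ {a b c d} (A : Matrix a c) (B : Matrix a d) (C : Matrix b c) (D : Matrix b d) →
    hcat (vcat A C) (vcat B D) ≈M blocks A B C D
  hcat-vcat-interchange A B C D = ≈M-blocks
    (λ i j → reflexive (≡.trans (hcat-↑ˡ (vcat A C) (vcat B D) _ j) (vcat-↑ˡ A C i j)))
    (λ i j → reflexive (≡.trans (hcat-↑ʳ (vcat A C) (vcat B D) _ j) (vcat-↑ˡ B D i j)))
    (λ i j → reflexive (≡.trans (hcat-↑ˡ (vcat A C) (vcat B D) _ j) (vcat-↑ʳ A C i j)))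
    (λ i j → reflexive (≡.trans (hcat-↑ʳ (vcat A C) (vcat B D) _ j) (vcat-↑ʳ B D i j)))

  vcat-*M-hcat : ∀ {a b k c d} (Q₁ : Matrix a k) (Q₂ : Matrix b k) (P₁ : Matrix k c) (P₂ : Matrix k d) →
    (vcat Q₁ Q₂ *M hcat P₁ P₂) ≈M blocks (Q₁ *M P₁) (Q₁ *M P₂) (Q₂ *M P₁) (Q₂ *M P₂)
  vcat-*M-hcat {k = k} Q₁ Q₂ P₁ P₂ = ≈M-blocks
    (λ i j → sumF-cong k (λ l → reflexive (≡.cong₂ _*_ (vcat-↑ˡ Q₁ Q₂ i l) (hcat-↑ˡ P₁ P₂ l j))))
    (λ i j → sumF-cong k (λ l → reflexive (≡.cong₂ _*_ (vcat-↑ˡ Q₁ Q₂ i l) (hcat-↑ʳ P₁ P₂ l j))))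
    (λ i j → sumF-cong k (λ l → reflexive (≡.cong₂ _*_ (vcat-↑ʳ Q₁ Q₂ i l) (hcat-↑ˡ P₁ P₂ l j))))
    (λ i j → sumF-cong k (λ l → reflexive (≡.cong₂ _*_ (vcat-↑ʳ Q₁ Q₂ i l) (hcat-↑ʳ P₁ P₂ l j))))

  *M-*M-zeroʳ : ∀ {a k l c} (Q : Matrix a k) (W : Matrix k l) → (Q *M (W *M 𝟎 {l} {c})) ≈M 𝟎
  *M-*M-zeroʳ Q W = ≈M-trans (*M-congˡ Q (*M-zeroʳ W)) (*M-zeroʳ Q)

  vcat-*M-*M-hcat : ∀ {a b k l c d} (Q₁ : Matrix a k) (Q₂ : Matrix b k) (W : Matrix k l)
    (P₁ : Matrix l c) (P₂ : Matrix l d) →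
    (vcat Q₁ Q₂ *M (W *M hcat P₁ P₂)) ≈M
      blocks (Q₁ *M (W *M P₁)) (Q₁ *M (W *M P₂)) (Q₂ *M (W *M P₁)) (Q₂ *M (W *M P₂))
  vcat-*M-*M-hcat Q₁ Q₂ W P₁ P₂ =
    ≈M-trans (*M-congˡ (vcat Q₁ Q₂) (*M-hcat W P₁ P₂)) (vcat-*M-hcat Q₁ Q₂ (W *M P₁) (W *M P₂))

  blocks--M-corner : ∀ {a b c d k l} (A : Matrix a c) (B : Matrix a d) (C : Matrix b c) (D : Matrix b d)
    (Q : Matrix a k) (W : Matrix k l) (P : Matrix l c) →
    (blocks A B C D -M (vcat Q (𝟎 {b}) *M (W *M hcat P (𝟎 {l} {d})))) ≈M blocks (A -M (Q *M (W *M P))) B C D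
  blocks--M-corner A B C D Q W P =
    ≈M-trans (-M-congʳ (blocks A B C D) (vcat-*M-*M-hcat Q 𝟎 W P 𝟎))
    (≈M-trans (blocks--M A _ B _ C _ D _)
      (blocks-cong ≈M-refl (-M-zeroʳ B (*M-*M-zeroʳ Q W))
                   (-M-zeroʳ C (*M-zeroˡ (W *M P))) (-M-zeroʳ D (*M-zeroˡ (W *M 𝟎)))))

  blocks--M-lowerRight : ∀ {a b c d k l} (A : Matrix a c) (B : Matrix a d) (C : Matrix b c) (D : Matrix b d)
    (Q : Matrix b k) (W : Matrix k l) (P : Matrix l d) →
    (blocks A B C D -M (vcat (𝟎 {a}) Q *M (W *M hcat (𝟎 {l} {c}) P))) ≈M blocks A B C (D -M (Q *M (W *M P)))
  blocks--M-lowerRight A B C D Q W P =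
    ≈M-trans (-M-congʳ (blocks A B C D) (vcat-*M-*M-hcat 𝟎 Q W 𝟎 P))
    (≈M-trans (blocks--M A _ B _ C _ D _)
      (blocks-cong (-M-zeroʳ A (*M-zeroˡ (W *M 𝟎))) (-M-zeroʳ B (*M-zeroˡ (W *M P)))
                   (-M-zeroʳ C (*M-*M-zeroʳ Q W)) ≈M-refl))

  -- Determinants

  minor : ∀ {n} → Matrix (suc n) (suc n) → Fin (suc n) → Matrix n n
  minor M j a b = M (suc a) (punchIn j b)

  laplaceTerm : ∀ {n} → Matrix (suc n) (suc n) → Fin (suc n) → Carrier
  laplaceTerm M j = signed (toℕ j) (M zero j * det (minor M j))

  signed-cong : ∀ k {x y} → x ≈ y → signed k x ≈ signed k y
  signed-cong zero    x≈y = x≈y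
  signed-cong (suc k) x≈y = -‿cong (signed-cong k x≈y)

  signed≈signed1* : ∀ k x → signed k x ≈ signed k 1# * x
  signed≈signed1* zero    x = sym (*-identityˡ x)
  signed≈signed1* (suc k) x = trans (-‿cong (signed≈signed1* k x)) (-‿distribˡ-* _ _)

  signed-zero : ∀ k {x} → x ≈ 0# → signed k x ≈ 0#
  signed-zero k {x} x≈0 = trans (signed≈signed1* k x) (trans (*-congˡ x≈0) (zeroʳ _))

  det-cong : ∀ {n} {A B : Matrix n n} → A ≈M B → det A ≈ det B
  det-cong {zero}  A≈B = refl
  det-cong {suc n} A≈B = sumF-cong (suc n) (λ j →
    signed-cong (toℕ j) (*-cong (A≈B zero j) (det-cong (λ a b → A≈B (suc a) (punchIn j b)))))

  det-𝐈 : ∀ n → det (𝐈 n) ≈ 1#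
  det-𝐈 zero    = refl
  det-𝐈 (suc n) = begin
    det (𝐈 (suc n))                                       ≈⟨ sumF-single (suc n) _ zero offDiagonal≈0 ⟩
    𝐈 (suc n) zero zero * det (minor (𝐈 (suc n)) zero)    ≈⟨ *-cong (𝐈-diag (suc n) zero) (det-cong minor≈𝐈) ⟩
    1# * det (𝐈 n)                                        ≈⟨ trans (*-identityˡ _) (det-𝐈 n) ⟩
    1#                                                    ∎
    where
    open ≈-Reasoning
    offDiagonal≈0 : ∀ j → j ≢ zero → laplaceTerm (𝐈 (suc n)) j ≈ 0#
    offDiagonal≈0 j j≢0 = signed-zero (toℕ j) (trans (*-congʳ (𝐈-offDiag (suc n) (j≢0 ∘ ≡.sym))) (zeroˡ _))
    minor≈𝐈 : minor (𝐈 (suc n)) zero ≈M 𝐈 n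
    minor≈𝐈 = 𝐈-reindex suc Fin.suc-injective

  signed-linear : ∀ k c {x a b} → x ≈ c * a + b → signed k x ≈ c * signed k a + signed k b
  signed-linear zero    c x≈ = x≈
  signed-linear (suc k) c {x} {a} {b} x≈ = begin
    - signed k x                              ≈⟨ -‿cong (signed-linear k c x≈) ⟩
    - (c * signed k a + signed k b)           ≈⟨ -‿+-comm _ _ ⟨
    - (c * signed k a) + - signed k b         ≈⟨ +-congʳ (-‿distribʳ-* c _) ⟩
    c * - signed k a + - signed k b           ∎
    where open ≈-Reasoning

  det-linearAt : ∀ {n} (A B C : Matrix n n) (k : Fin n) (c : Carrier) →
    (∀ i j → j ≢ k → A i j ≈ C i j) → (∀ i j → j ≢ k → B i j ≈ C i j) →
    (∀ i → C i k ≈ c * A i k + B i k) → det C ≈ c * det A + det B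
  det-linearAt {suc n} A B C k c A≈C B≈C Cₖ≈ = begin
    det C
      ≈⟨ sumF-cong (suc n) (λ j → signed-linear (toℕ j) c (term≈ j)) ⟩
    sumF (suc n) (λ j → c * laplaceTerm A j + laplaceTerm B j)
      ≈⟨ sumF-distrib-+ (suc n) (λ j → c * laplaceTerm A j) (laplaceTerm B) ⟩
    sumF (suc n) (λ j → c * laplaceTerm A j) + det B
      ≈⟨ +-congʳ (*-distribˡ-sumF (suc n) c (laplaceTerm A)) ⟨
    c * det A + det B ∎
    where
    open ≈-Reasoning
    term≈ : ∀ j → C zero j * det (minor C j) ≈ c * (A zero j * det (minor A j)) + B zero j * det (minor B j)
    term≈ j with j ≟ k
    ... | yes ≡.refl = begin
          C zero j * det (minor C j)                                   ≈⟨ *-cong (Cₖ≈ zero) (sym minorA≈) ⟩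
          (c * A zero j + B zero j) * det (minor A j)                  ≈⟨ distribʳ _ _ _ ⟩
          c * A zero j * det (minor A j) + B zero j * det (minor A j)
            ≈⟨ +-cong (*-assoc _ _ _) (*-congˡ (trans minorA≈ (sym minorB≈))) ⟩
          c * (A zero j * det (minor A j)) + B zero j * det (minor B j) ∎
      where
      minorA≈ : det (minor A j) ≈ det (minor C j)
      minorA≈ = det-cong (λ a b → A≈C (suc a) (punchIn j b) (Fin.punchInᵢ≢i j b))
      minorB≈ : det (minor B j) ≈ det (minor C j)
      minorB≈ = det-cong (λ a b → B≈C (suc a) (punchIn j b) (Fin.punchInᵢ≢i j b))
    ... | no j≢k = begin
          C zero j * det (minor C j)                                     ≈⟨ *-congˡ minor≈ ⟩
          C zero j * (c * det (minor A j) + det (minor B j))             ≈⟨ distribˡ _ _ _ ⟩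
          C zero j * (c * det (minor A j)) + C zero j * det (minor B j)
            ≈⟨ +-cong (trans (x∙yz≈y∙xz _ _ _) (*-congˡ (*-congʳ (sym (A≈C zero j j≢k)))))
                      (*-congʳ (sym (B≈C zero j j≢k))) ⟩
          c * (A zero j * det (minor A j)) + B zero j * det (minor B j)  ∎
      where
      k′ = punchOut j≢k
      punchIn≢k : ∀ b → b ≢ k′ → punchIn j b ≢ k
      punchIn≢k b b≢k′ eq = b≢k′ (Fin.punchIn-injective j b k′ (≡.trans eq (≡.sym (Fin.punchIn-punchOut j≢k))))
      minor≈ : det (minor C j) ≈ c * det (minor A j) + det (minor B j)
      minor≈ = det-linearAt (minor A j) (minor B j) (minor C j) k′ c
        (λ a b b≢k′ → A≈C (suc a) (punchIn j b) (punchIn≢k b b≢k′))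
        (λ a b b≢k′ → B≈C (suc a) (punchIn j b) (punchIn≢k b b≢k′))
        (λ a → ≡.subst (λ z → C (suc a) z ≈ c * A (suc a) z + B (suc a) z)
                       (≡.sym (Fin.punchIn-punchOut j≢k)) (Cₖ≈ (suc a)))

  det-additiveAt : ∀ {n} (A B C : Matrix n n) (k : Fin n) →
    (∀ i j → j ≢ k → A i j ≈ C i j) → (∀ i j → j ≢ k → B i j ≈ C i j) →
    (∀ i → C i k ≈ A i k + B i k) → det C ≈ det A + det B
  det-additiveAt A B C k A≈C B≈C Cₖ≈ =
    trans (det-linearAt A B C k 1# A≈C B≈C (λ i → trans (Cₖ≈ i) (+-congʳ (sym (*-identityˡ _)))))
          (+-congʳ (*-identityˡ _))

  punchIn-adjacent : ∀ {n} (p q : Fin (suc n)) (b : Fin n) → toℕ q ≡ suc (toℕ p) →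
    punchIn p b ≡ punchIn q b ⊎ (punchIn p b ≡ q × punchIn q b ≡ p)
  punchIn-adjacent zero    (suc zero)     zero    _  = inj₂ (≡.refl , ≡.refl)
  punchIn-adjacent zero    (suc zero)     (suc b) _  = inj₁ ≡.refl
  punchIn-adjacent (suc p) (suc q)        zero    _  = inj₁ ≡.refl
  punchIn-adjacent (suc p) (suc q)        (suc b) eq =
    Sum.map (≡.cong suc) (Product.map (≡.cong suc) (≡.cong suc)) (punchIn-adjacent p q b (ℕₚ.suc-injective eq))

  punchOut-adjacent : ∀ {n} (j p q : Fin (suc n)) (j≢p : j ≢ p) (j≢q : j ≢ q) → toℕ q ≡ suc (toℕ p) →
    toℕ (punchOut j≢q) ≡ suc (toℕ (punchOut j≢p))
  punchOut-adjacent zero          zero    _             j≢p _   _  = ⊥-elim (j≢p ≡.refl)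
  punchOut-adjacent zero          (suc p) (suc q)       _   _   eq = ℕₚ.suc-injective eq
  punchOut-adjacent (suc zero)    zero    (suc zero)    _   j≢q _  = ⊥-elim (j≢q ≡.refl)
  punchOut-adjacent {suc (suc n)} (suc (suc j)) zero (suc zero) _ _ _ = ≡.refl
  punchOut-adjacent {suc n} (suc j) (suc p) (suc q)     j≢p j≢q eq =
    ≡.cong suc (punchOut-adjacent j p q (j≢p ∘ ≡.cong suc) (j≢q ∘ ≡.cong suc) (ℕₚ.suc-injective eq))

  det-adjacentEqualColumns : ∀ {n} (M : Matrix n n) (p q : Fin n) → toℕ q ≡ suc (toℕ p) →
    (∀ i → M i p ≈ M i q) → det M ≈ 0#
  det-adjacentEqualColumns {suc n} M p q q≡1+p Mₚ≈M_q = begin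
    det M                                    ≈⟨ sumF-pair (suc n) (laplaceTerm M) p q p≢q otherTerm≈0 ⟩
    laplaceTerm M p + laplaceTerm M q        ≈⟨ +-congˡ (reflexive (≡.cong₂ signed q≡1+p ≡.refl)) ⟩
    laplaceTerm M p - signed (toℕ p) (M zero q * det (minor M q))
      ≈⟨ +-congˡ (-‿cong (signed-cong (toℕ p) (*-cong (sym (Mₚ≈M_q zero)) (det-cong minorq≈minorp)))) ⟩
    laplaceTerm M p - laplaceTerm M p        ≈⟨ -‿inverseʳ _ ⟩
    0#                                       ∎
    where
    open ≈-Reasoning
    p≢q : p ≢ q
    p≢q p≡q = ℕₚ.1+n≢n (≡.sym (≡.trans (≡.cong toℕ p≡q) q≡1+p))
    otherTerm≈0 : ∀ j → j ≢ p → j ≢ q → laplaceTerm M j ≈ 0#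
    otherTerm≈0 j j≢p j≢q = signed-zero (toℕ j) (trans (*-congˡ minor≈0) (zeroʳ _))
      where
      minor≈0 : det (minor M j) ≈ 0#
      minor≈0 = det-adjacentEqualColumns (minor M j) (punchOut j≢p) (punchOut j≢q)
        (punchOut-adjacent j p q j≢p j≢q q≡1+p)
        (λ a → trans (reflexive (≡.cong (M (suc a)) (Fin.punchIn-punchOut j≢p)))
               (trans (Mₚ≈M_q (suc a)) (reflexive (≡.cong (M (suc a)) (≡.sym (Fin.punchIn-punchOut j≢q))))))
    minorq≈minorp : minor M q ≈M minor M p
    minorq≈minorp a b with punchIn-adjacent p q b q≡1+p
    ... | inj₁ eq         = reflexive (≡.cong (M (suc a)) (≡.sym eq))
    ... | inj₂ (eqp , eqq) = trans (reflexive (≡.cong (M (suc a)) eqq))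
                               (trans (Mₚ≈M_q (suc a)) (reflexive (≡.cong (M (suc a)) (≡.sym eqp))))

  setColumn : ∀ {n m} → Matrix n m → Fin m → (Fin n → Carrier) → Matrix n m
  setColumn M k v i j with j ≟ k
  ... | yes _ = v i
  ... | no  _ = M i j

  setColumn-at : ∀ {n m} (M : Matrix n m) k v i → setColumn M k v i k ≈ v i
  setColumn-at M k v i with k ≟ k
  ... | yes _   = refl
  ... | no k≢k = ⊥-elim (k≢k ≡.refl)

  setColumn-off : ∀ {n m} (M : Matrix n m) k v i {j} → j ≢ k → setColumn M k v i j ≈ M i j
  setColumn-off M k v i {j} j≢k with j ≟ k
  ... | yes j≡k = ⊥-elim (j≢k j≡k)
  ... | no  _   = refl

  setColumn-congOff : ∀ {n m} {A B : Matrix n m} {k} → (∀ i j → j ≢ k → A i j ≈ B i j) →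
    ∀ p v i j → j ≢ k → setColumn A p v i j ≈ setColumn B p v i j
  setColumn-congOff A≈B p v i j j≢k with j ≟ p
  ... | yes _ = refl
  ... | no  _ = A≈B i j j≢k

  module _ {n} (M : Matrix n n) {p q : Fin n} (p≢q : p ≢ q) where

    setColumns : (x y : Fin n → Carrier) → Matrix n n
    setColumns x y = setColumn (setColumn M q y) p x

    setColumns-atp : ∀ x y i → setColumns x y i p ≈ x i
    setColumns-atp x y = setColumn-at _ p x

    setColumns-atq : ∀ x y i → setColumns x y i q ≈ y i
    setColumns-atq x y i = trans (setColumn-off _ p x i (p≢q ∘ ≡.sym)) (setColumn-at M q y i)

    setColumns-off : ∀ x y i {j} → j ≢ p → j ≢ q → setColumns x y i j ≈ M i j
    setColumns-off x y i j≢p j≢q = trans (setColumn-off _ p x i j≢p) (setColumn-off M q y i j≢q)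

    setColumns-congOffp : ∀ x x′ y i j → j ≢ p → setColumns x y i j ≈ setColumns x′ y i j
    setColumns-congOffp x x′ y i j j≢p = trans (setColumn-off _ p x i j≢p) (sym (setColumn-off _ p x′ i j≢p))

    setColumns-congOffq : ∀ x y y′ i j → j ≢ q → setColumns x y i j ≈ setColumns x y′ i j
    setColumns-congOffq x y y′ =
      setColumn-congOff (λ i j j≢q → trans (setColumn-off M q y i j≢q) (sym (setColumn-off M q y′ i j≢q))) p x

    setColumns-unchanged : setColumns (λ i → M i p) (λ i → M i q) ≈M M
    setColumns-unchanged i j = byColumn j (j ≟ p) (j ≟ q)
      where
      byColumn : ∀ j → Dec (j ≡ p) → Dec (j ≡ q) → setColumns (λ i → M i p) (λ i → M i q) i j ≈ M i j
      byColumn j (yes ≡.refl) _            = setColumns-atp _ _ i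
      byColumn j (no j≢p)     (yes ≡.refl) = setColumns-atq _ _ i
      byColumn j (no j≢p)     (no j≢q)     = setColumns-off _ _ i j≢p j≢q

    -- Expand det with columns p and q both replaced by their sum, first at p and then at q.
    det-swapColumns : (∀ K → (∀ i → K i p ≈ K i q) → det K ≈ 0#) →
      det (setColumns (λ i → M i q) (λ i → M i p)) ≈ - det M
    det-swapColumns alternating = +-inverseʳ-unique (det M) (det (S v u)) (begin
      det M + det (S v u)
        ≈⟨ +-congʳ (det-cong setColumns-unchanged) ⟨
      det (S u v) + det (S v u)
        ≈⟨ +-cong (+-identityˡ _) (+-identityʳ _) ⟨
      (0# + det (S u v)) + (det (S v u) + 0#)
        ≈⟨ +-cong (+-congʳ (S[x,x]≈0 u)) (+-congˡ (S[x,x]≈0 v)) ⟨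
      (det (S u u) + det (S u v)) + (det (S v u) + det (S v v))
        ≈⟨ +-cong (linearAtq u) (linearAtq v) ⟨
      det (S u w) + det (S v w)
        ≈⟨ linearAtp w ⟨
      det (S w w)
        ≈⟨ S[x,x]≈0 w ⟩
      0# ∎)
      where
      open ≈-Reasoning
      S = setColumns
      u v w : Fin n → Carrier
      u i = M i p
      v i = M i q
      w i = u i + v i
      S[x,x]≈0 : ∀ x → det (S x x) ≈ 0#
      S[x,x]≈0 x = alternating (S x x) (λ i → trans (setColumns-atp x x i) (sym (setColumns-atq x x i)))
      linearAtp : ∀ y → det (S w y) ≈ det (S u y) + det (S v y)
      linearAtp y = det-additiveAt (S u y) (S v y) (S w y) p
        (setColumns-congOffp u w y) (setColumns-congOffp v w y)
        (λ i → trans (setColumns-atp w y i) (sym (+-cong (setColumns-atp u y i) (setColumns-atp v y i))))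
      linearAtq : ∀ x → det (S x w) ≈ det (S x u) + det (S x v)
      linearAtq x = det-additiveAt (S x u) (S x v) (S x w) q
        (setColumns-congOffq x u w) (setColumns-congOffq x v w)
        (λ i → trans (setColumns-atq x w i) (sym (+-cong (setColumns-atq x u i) (setColumns-atq x v i))))

  -- Swapping q with its left neighbour r moves the equal columns one step closer.
  det-equalColumnsAtDistance : ∀ d {n} (M : Matrix n n) (p q : Fin n) → toℕ q ≡ suc (d ℕ.+ toℕ p) →
    (∀ i → M i p ≈ M i q) → det M ≈ 0#
  det-equalColumnsAtDistance zero    M p q         q≡ Mₚ≈M_q = det-adjacentEqualColumns M p q q≡ Mₚ≈M_q
  det-equalColumnsAtDistance (suc d) M p (suc q′) q≡ Mₚ≈M_q = begin
    det M          ≈⟨ -‿involutive _ ⟨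
    - (- det M)    ≈⟨ -‿cong (sym (det-swapColumns M r≢q (λ K → det-adjacentEqualColumns K r q q≡1+r))) ⟩
    - det M′       ≈⟨ -‿cong (det-equalColumnsAtDistance d M′ p r r≡ M′ₚ≈M′ᵣ) ⟩
    - 0#           ≈⟨ -0#≈0# ⟩
    0#             ∎
    where
    open ≈-Reasoning
    q = suc q′
    r = Fin.inject₁ q′
    r≡ : toℕ r ≡ suc (d ℕ.+ toℕ p)
    r≡ = ≡.trans (Fin.toℕ-inject₁ q′) (ℕₚ.suc-injective q≡)
    q≡1+r : toℕ q ≡ suc (toℕ r)
    q≡1+r = ≡.cong suc (≡.sym (Fin.toℕ-inject₁ q′))
    r≢q : r ≢ q
    r≢q r≡q = ℕₚ.1+n≢n (≡.sym (≡.trans (≡.cong toℕ r≡q) q≡1+r))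
    p≢r : p ≢ r
    p≢r p≡r = ℕₚ.m≢1+n+m (toℕ p) (≡.trans (≡.cong toℕ p≡r) r≡)
    p≢q : p ≢ q
    p≢q p≡q = ℕₚ.m≢1+n+m (toℕ p) {suc d} (≡.trans (≡.cong toℕ p≡q) q≡)
    M′ = setColumns M r≢q (λ i → M i q) (λ i → M i r)
    M′ₚ≈M′ᵣ : ∀ i → M′ i p ≈ M′ i r
    M′ₚ≈M′ᵣ i = begin
      M′ i p   ≈⟨ setColumns-off M r≢q _ _ i p≢r p≢q ⟩
      M i p    ≈⟨ Mₚ≈M_q i ⟩
      M i q    ≈⟨ setColumns-atp M r≢q _ _ i ⟨
      M′ i r   ∎

  det-equalColumns-< : ∀ {n} (M : Matrix n n) (p q : Fin n) → toℕ p ℕ.< toℕ q →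
    (∀ i → M i p ≈ M i q) → det M ≈ 0#
  det-equalColumns-< M p q p<q with ℕₚ.m≤n⇒∃[o]m+o≡n p<q
  ... | d , 1+p+d≡q = det-equalColumnsAtDistance d M p q
                        (≡.trans (≡.sym 1+p+d≡q) (≡.cong suc (ℕₚ.+-comm (toℕ p) d)))

  det-equalColumns : ∀ {n} (M : Matrix n n) (p q : Fin n) → p ≢ q → (∀ i → M i p ≈ M i q) → det M ≈ 0#
  det-equalColumns M p q p≢q Mₚ≈M_q with ℕₚ.<-cmp (toℕ p) (toℕ q)
  ... | tri< p<q _ _ = det-equalColumns-< M p q p<q Mₚ≈M_q
  ... | tri≈ _ p≡q _ = ⊥-elim (p≢q (Fin.toℕ-injective p≡q))
  ... | tri> _ _ q<p = det-equalColumns-< M q p q<p (sym ∘ Mₚ≈M_q)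

  -- Column operations

  det-linearAt-sumF : ∀ {n} m (M M′ : Matrix n n) (k : Fin n) (c : Fin m → Carrier) (u : Fin m → Fin n → Carrier) →
    (∀ i j → j ≢ k → M′ i j ≈ M i j) → (∀ i → M′ i k ≈ M i k + sumF m (λ l → c l * u l i)) →
    det M′ ≈ det M + sumF m (λ l → c l * det (setColumn M k (u l)))
  det-linearAt-sumF zero M M′ k c u M′≈M M′ₖ≈ = trans (det-cong M′≈M-everywhere) (sym (+-identityʳ _))
    where
    M′≈M-everywhere : M′ ≈M M
    M′≈M-everywhere i j with j ≟ k
    ... | yes ≡.refl = trans (M′ₖ≈ i) (+-identityʳ _)
    ... | no j≢k     = M′≈M i j j≢k
  det-linearAt-sumF (suc m) M M′ k c u M′≈M M′ₖ≈ = begin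
    det M′                              ≈⟨ det-linearAt A B M′ k (c zero) A≈M′ B≈M′ M′ₖ≈cA+B ⟩
    c zero * det A + det B
      ≈⟨ +-congˡ (det-linearAt-sumF m M B k (c ∘ suc) (u ∘ suc) B≈M (setColumn-at M k _)) ⟩
    c zero * det A + (det M + rest)     ≈⟨ x+[y+z]≈y+[x+z] _ _ _ ⟩
    det M + (c zero * det A + rest)     ∎
    where
    open ≈-Reasoning
    rest = sumF m (λ l → c (suc l) * det (setColumn M k (u (suc l))))
    A = setColumn M k (u zero)
    B = setColumn M k (λ i → M i k + sumF m (λ l → c (suc l) * u (suc l) i))
    B≈M : ∀ i j → j ≢ k → B i j ≈ M i j
    B≈M i j = setColumn-off M k _ i
    A≈M′ : ∀ i j → j ≢ k → A i j ≈ M′ i j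
    A≈M′ i j j≢k = trans (setColumn-off M k _ i j≢k) (sym (M′≈M i j j≢k))
    B≈M′ : ∀ i j → j ≢ k → B i j ≈ M′ i j
    B≈M′ i j j≢k = trans (B≈M i j j≢k) (sym (M′≈M i j j≢k))
    M′ₖ≈cA+B : ∀ i → M′ i k ≈ c zero * A i k + B i k
    M′ₖ≈cA+B i = trans (M′ₖ≈ i) (trans (x+[y+z]≈y+[x+z] _ _ _)
                   (sym (+-cong (*-congˡ (setColumn-at M k _ i)) (setColumn-at M k _ i))))

  det-addColumnCombination : ∀ {n} (M M′ : Matrix n n) (k : Fin n) (c : Fin n → Carrier) → c k ≈ 0# →
    (∀ i j → j ≢ k → M′ i j ≈ M i j) → (∀ i → M′ i k ≈ M i k + sumF n (λ l → c l * M i l)) →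
    det M′ ≈ det M
  det-addColumnCombination {n} M M′ k c cₖ≈0 M′≈M M′ₖ≈ =
    trans (det-linearAt-sumF n M M′ k c (λ l i → M i l) M′≈M M′ₖ≈)
          (trans (+-congˡ (sumF-zero n term≈0)) (+-identityʳ _))
    where
    term≈0 : ∀ l → c l * det (setColumn M k (λ i → M i l)) ≈ 0#
    term≈0 l with l ≟ k
    ... | yes ≡.refl = trans (*-congʳ cₖ≈0) (zeroˡ _)
    ... | no l≢k     = trans (*-congˡ (det-equalColumns _ k l (l≢k ∘ ≡.sym)
                         (λ i → trans (setColumn-at M k _ i) (sym (setColumn-off M k _ i l≢k))))) (zeroʳ _)

  columnsBelow : ∀ {n m} → ℕ → Matrix n m → Matrix n m
  columnsBelow k X l j with toℕ j ℕ.<? k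
  ... | yes _ = X l j
  ... | no  _ = 0#

  columnsBelow-< : ∀ {n m} k (X : Matrix n m) l j → toℕ j ℕ.< k → columnsBelow k X l j ≈ X l j
  columnsBelow-< k X l j j<k with toℕ j ℕ.<? k
  ... | yes _   = refl
  ... | no j≮k = ⊥-elim (j≮k j<k)

  columnsBelow-≮ : ∀ {n m} k (X : Matrix n m) l j → ¬ toℕ j ℕ.< k → columnsBelow k X l j ≈ 0#
  columnsBelow-≮ k X l j j≮k with toℕ j ℕ.<? k
  ... | yes j<k = ⊥-elim (j≮k j<k)
  ... | no _    = refl

  columnsBelow-suc : ∀ {n m} k (X : Matrix n m) l j → toℕ j ≢ k → columnsBelow (suc k) X l j ≈ columnsBelow k X l j
  columnsBelow-suc k X l j j≢k with toℕ j ℕ.<? suc k | toℕ j ℕ.<? k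
  ... | yes _     | yes _   = refl
  ... | no  _     | no  _   = refl
  ... | no j≮1+k  | yes j<k = ⊥-elim (j≮1+k (ℕₚ.m≤n⇒m≤1+n j<k))
  ... | yes j<1+k | no j≮k  = ⊥-elim (j≢k (ℕₚ.≤-antisym (ℕ.s≤s⁻¹ j<1+k) (ℕₚ.≮⇒≥ j≮k)))

  -- The columns in T are updated one at a time (partialUpdate k has done those left of k).  Each
  -- update adds a combination of columns outside T, and those columns never change.
  module _ {n} (M X : Matrix n n) (T : Fin n → Bool)
           (support : ∀ l j → X l j ≈ 0# ⊎ (T l ≡ false × T j ≡ true)) where

    private
      X≈0-outsideT : ∀ l j → T j ≡ false → X l j ≈ 0#
      X≈0-outsideT l j Tj≡false with support l j
      ... | inj₁ Xlj≈0          = Xlj≈0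
      ... | inj₂ (_ , Tj≡true) = ⊥-elim (Bool.not-¬ Tj≡true Tj≡false)

      X≈0-fromT : ∀ l j → T l ≡ true → X l j ≈ 0#
      X≈0-fromT l j Tl≡true with support l j
      ... | inj₁ Xlj≈0           = Xlj≈0
      ... | inj₂ (Tl≡false , _) = ⊥-elim (Bool.not-¬ Tl≡false Tl≡true)

    partialUpdate : ℕ → Matrix n n
    partialUpdate k = M +M (M *M columnsBelow k X)

    partialUpdate-unchanged : ∀ k i j → (∀ l → columnsBelow k X l j ≈ 0#) → partialUpdate k i j ≈ M i j
    partialUpdate-unchanged k i j X≈0 =
      trans (+-congˡ (sumF-zero n (λ l → trans (*-congˡ (X≈0 l)) (zeroʳ _)))) (+-identityʳ _)

    partialUpdate-outsideT : ∀ k i l → T l ≡ false → partialUpdate k i l ≈ M i l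
    partialUpdate-outsideT k i l Tl≡false = partialUpdate-unchanged k i l X≈0
      where
      X≈0 : ∀ l′ → columnsBelow k X l′ l ≈ 0#
      X≈0 l′ with toℕ l ℕ.<? k
      ... | yes _ = X≈0-outsideT l′ l Tl≡false
      ... | no  _ = refl

    det-partialUpdate-suc : ∀ k → k ℕ.< n → det (partialUpdate (suc k)) ≈ det (partialUpdate k)
    det-partialUpdate-suc k k<n =
      det-addColumnCombination (partialUpdate k) (partialUpdate (suc k)) jₖ (λ l → X l jₖ) Xjₖjₖ≈0 unchanged updated
      where
      jₖ = Fin.fromℕ< k<n
      toℕjₖ≡k : toℕ jₖ ≡ k
      toℕjₖ≡k = Fin.toℕ-fromℕ< k<n
      jₖ<1+k : toℕ jₖ ℕ.< suc k
      jₖ<1+k = ℕₚ.≤-reflexive (≡.cong suc toℕjₖ≡k)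
      Xjₖjₖ≈0 : X jₖ jₖ ≈ 0#
      Xjₖjₖ≈0 with T jₖ in Tjₖ
      ... | true  = X≈0-fromT jₖ jₖ Tjₖ
      ... | false = X≈0-outsideT jₖ jₖ Tjₖ
      unchanged : ∀ i j → j ≢ jₖ → partialUpdate (suc k) i j ≈ partialUpdate k i j
      unchanged i j j≢jₖ = +-congˡ (sumF-cong n (λ l → *-congˡ
        (columnsBelow-suc k X l j (λ j≡k → j≢jₖ (Fin.toℕ-injective (≡.trans j≡k (≡.sym toℕjₖ≡k)))))))
      updated : ∀ i → partialUpdate (suc k) i jₖ ≈ partialUpdate k i jₖ + sumF n (λ l → X l jₖ * partialUpdate k i l)
      updated i = begin
        M i jₖ + sumF n (λ l → M i l * columnsBelow (suc k) X l jₖ)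
          ≈⟨ +-congˡ (sumF-cong n (λ l → *-congˡ (columnsBelow-< (suc k) X l jₖ jₖ<1+k))) ⟩
        M i jₖ + sumF n (λ l → M i l * X l jₖ)
          ≈⟨ +-cong (sym (partialUpdate-unchanged k i jₖ (λ l → columnsBelow-≮ k X l jₖ (ℕₚ.<-irrefl toℕjₖ≡k))))
                    (sumF-cong n term≈) ⟩
        partialUpdate k i jₖ + sumF n (λ l → X l jₖ * partialUpdate k i l) ∎
        where
        open ≈-Reasoning
        term≈ : ∀ l → M i l * X l jₖ ≈ X l jₖ * partialUpdate k i l
        term≈ l with T l in Tl
        ... | true  = trans (*-congˡ (X≈0-fromT l jₖ Tl))
                        (trans (zeroʳ _) (sym (trans (*-congʳ (X≈0-fromT l jₖ Tl)) (zeroˡ _))))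
        ... | false = trans (*-comm _ _) (*-congˡ (sym (partialUpdate-outsideT k i l Tl)))

    det-partialUpdate : ∀ k → k ℕ.≤ n → det (partialUpdate k) ≈ det M
    det-partialUpdate zero    _     =
      det-cong (λ i j → partialUpdate-unchanged 0 i j (λ l → columnsBelow-≮ 0 X l j (λ ())))
    det-partialUpdate (suc k) 1+k≤n =
      trans (det-partialUpdate-suc k 1+k≤n) (det-partialUpdate k (ℕₚ.≤-trans (ℕₚ.n≤1+n k) 1+k≤n))

    det-+M-*M : det (M +M (M *M X)) ≈ det M
    det-+M-*M = trans (det-cong updateAll≈) (det-partialUpdate n ℕₚ.≤-refl)
      where
      updateAll≈ : (M +M (M *M X)) ≈M partialUpdate n
      updateAll≈ i j = +-congˡ (sumF-cong n (λ l → *-congˡ (sym (columnsBelow-< n X l j (Fin.toℕ<n j)))))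

  punchIn-↑ˡ : ∀ {a} b (j : Fin (suc a)) (y : Fin a) → punchIn (j ↑ˡ b) (y ↑ˡ b) ≡ punchIn j y ↑ˡ b
  punchIn-↑ˡ b zero    y       = ≡.refl
  punchIn-↑ˡ b (suc j) zero    = ≡.refl
  punchIn-↑ˡ b (suc j) (suc y) = ≡.cong suc (punchIn-↑ˡ b j y)

  punchIn-↑ˡ-↑ʳ : ∀ a {b} (j : Fin (suc a)) (y : Fin b) → punchIn (j ↑ˡ b) (a ↑ʳ y) ≡ suc a ↑ʳ y
  punchIn-↑ˡ-↑ʳ a       zero    y = ≡.refl
  punchIn-↑ˡ-↑ʳ (suc a) (suc j) y = ≡.cong suc (punchIn-↑ˡ-↑ʳ a j y)

  det-blocks-lowerTriangular : ∀ a {b} (A : Matrix a a) (C : Matrix b a) (D : Matrix b b) →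
    det (blocks A 𝟎 C D) ≈ det A * det D
  det-blocks-lowerTriangular zero    A C D = sym (*-identityˡ _)
  det-blocks-lowerTriangular (suc a) {b} A C D = begin
    det B                                                      ≈⟨ sumF-splitAt (suc a) b (laplaceTerm B) ⟩
    sumF (suc a) (λ j → laplaceTerm B (j ↑ˡ b)) + sumF b (λ j → laplaceTerm B (suc a ↑ʳ j))
      ≈⟨ +-cong (sumF-cong (suc a) leftTerm≈) (sumF-zero b rightTerm≈0) ⟩
    sumF (suc a) (λ j → laplaceTerm A j * det D) + 0#          ≈⟨ +-identityʳ _ ⟩
    sumF (suc a) (λ j → laplaceTerm A j * det D)               ≈⟨ *-distribʳ-sumF (suc a) (det D) (laplaceTerm A) ⟨
    det A * det D                                              ∎
    where
    open ≈-Reasoning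
    B = blocks A 𝟎 C D
    rightTerm≈0 : ∀ j → laplaceTerm B (suc a ↑ʳ j) ≈ 0#
    rightTerm≈0 j = signed-zero (toℕ (suc a ↑ʳ j))
      (trans (*-congʳ (reflexive (blocks-↑ˡ-↑ʳ A 𝟎 C D zero j))) (zeroˡ _))
    minor≈ : ∀ j → minor B (j ↑ˡ b) ≈M blocks (minor A j) 𝟎 (λ x y → C x (punchIn j y)) D
    minor≈ j = ≈M-blocks
      (λ x y → reflexive (≡.trans (≡.cong (B (suc x ↑ˡ b)) (punchIn-↑ˡ b j y)) (blocks-↑ˡ-↑ˡ A 𝟎 C D (suc x) _)))
      (λ x y → reflexive (≡.trans (≡.cong (B (suc x ↑ˡ b)) (punchIn-↑ˡ-↑ʳ a j y)) (blocks-↑ˡ-↑ʳ A 𝟎 C D (suc x) y)))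
      (λ x y → reflexive (≡.trans (≡.cong (B (suc a ↑ʳ x)) (punchIn-↑ˡ b j y)) (blocks-↑ʳ-↑ˡ A 𝟎 C D x _)))
      (λ x y → reflexive (≡.trans (≡.cong (B (suc a ↑ʳ x)) (punchIn-↑ˡ-↑ʳ a j y)) (blocks-↑ʳ-↑ʳ A 𝟎 C D x y)))
    leftTerm≈ : ∀ j → laplaceTerm B (j ↑ˡ b) ≈ laplaceTerm A j * det D
    leftTerm≈ j = begin
      signed (toℕ (j ↑ˡ b)) (B zero (j ↑ˡ b) * det (minor B (j ↑ˡ b)))
        ≈⟨ reflexive (≡.cong₂ signed (Fin.toℕ-↑ˡ j b) ≡.refl) ⟩
      signed (toℕ j) (B zero (j ↑ˡ b) * det (minor B (j ↑ˡ b)))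
        ≈⟨ signed-cong (toℕ j) (*-cong (reflexive (blocks-↑ˡ-↑ˡ A 𝟎 C D zero j))
             (trans (det-cong (minor≈ j)) (det-blocks-lowerTriangular a (minor A j) _ D))) ⟩
      signed (toℕ j) (A zero j * (det (minor A j) * det D))
        ≈⟨ signed-cong (toℕ j) (sym (*-assoc _ _ _)) ⟩
      signed (toℕ j) (A zero j * det (minor A j) * det D)
        ≈⟨ trans (signed≈signed1* (toℕ j) _)
                 (trans (sym (*-assoc _ _ _)) (*-congʳ (sym (signed≈signed1* (toℕ j) _)))) ⟩
      laplaceTerm A j * det D  ∎

  inRightBlock : ∀ {a b} → Fin (a ℕ.+ b) → Bool
  inRightBlock {a} j = Sum.[ (λ _ → false) , (λ _ → true) ]′ (splitAt a j)

  inRightBlock-↑ˡ : ∀ {a} b (i : Fin a) → inRightBlock {a} {b} (i ↑ˡ b) ≡ false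
  inRightBlock-↑ˡ {a} b i = ≡.cong Sum.[ (λ _ → false) , (λ _ → true) ]′ (Fin.splitAt-↑ˡ a i b)

  inRightBlock-↑ʳ : ∀ a {b} (i : Fin b) → inRightBlock {a} {b} (a ↑ʳ i) ≡ true
  inRightBlock-↑ʳ a {b} i = ≡.cong Sum.[ (λ _ → false) , (λ _ → true) ]′ (Fin.splitAt-↑ʳ a b i)

  +M-zeroProducts : ∀ {r s k l} (W : Matrix r s) (P : Matrix r k) (Q : Matrix r l) →
    (W +M ((P *M 𝟎) +M (Q *M 𝟎))) ≈M W
  +M-zeroProducts W P Q i j = trans (+-congˡ (x≈0∧y≈0⇒x+y≈0 (*M-zeroʳ P i j) (*M-zeroʳ Q i j))) (+-identityʳ _)

  det-blocks-addRight : ∀ {a b} (A : Matrix a a) (B : Matrix a b) (C : Matrix b a) (D : Matrix b b)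
    (Y : Matrix a b) →
    det (blocks A (B +M (A *M Y)) C (D +M (C *M Y))) ≈ det (blocks A B C D)
  det-blocks-addRight {a} {b} A B C D Y =
    trans (det-cong (≈M-sym added≈)) (det-+M-*M (blocks A B C D) X (inRightBlock {a} {b}) support)
    where
    X : Matrix (a ℕ.+ b) (a ℕ.+ b)
    X = blocks 𝟎 Y 𝟎 𝟎
    support : ∀ l j → X l j ≈ 0# ⊎ (inRightBlock {a} {b} l ≡ false × inRightBlock {a} {b} j ≡ true)
    support = ↑-elim {a} {b} _
      (λ l → ↑-elim {a} {b} _ (λ j → inj₁ (reflexive (blocks-↑ˡ-↑ˡ 𝟎 Y 𝟎 𝟎 l j)))
                      (λ j → inj₂ (inRightBlock-↑ˡ b l , inRightBlock-↑ʳ a j)))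
      (λ l → ↑-elim {a} {b} _ (λ j → inj₁ (reflexive (blocks-↑ʳ-↑ˡ 𝟎 Y 𝟎 𝟎 l j)))
                      (λ j → inj₁ (reflexive (blocks-↑ʳ-↑ʳ 𝟎 Y 𝟎 𝟎 l j))))
    +M-dropZero : ∀ {r s k l} (W : Matrix r s) (P : Matrix r k) (Q : Matrix r l) {Y′} →
      (W +M ((P *M Y′) +M (Q *M 𝟎))) ≈M (W +M (P *M Y′))
    +M-dropZero W P Q i j = +-congˡ (trans (+-congˡ (*M-zeroʳ Q i j)) (+-identityʳ _))
    added≈ : (blocks A B C D +M (blocks A B C D *M X)) ≈M blocks A (B +M (A *M Y)) C (D +M (C *M Y))
    added≈ = ≈M-trans (λ i j → +-congˡ (blocks-*M A B C D 𝟎 Y 𝟎 𝟎 i j))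
      (≈M-trans (blocks-+M A _ B _ C _ D _)
      (blocks-cong (+M-zeroProducts A A B) (+M-dropZero B A B) (+M-zeroProducts C C D) (+M-dropZero D C D)))

  det-blocks-addLeft : ∀ {a b} (A : Matrix a a) (B : Matrix a b) (C : Matrix b a) (D : Matrix b b)
    (Y : Matrix b a) →
    det (blocks (A +M (B *M Y)) B (C +M (D *M Y)) D) ≈ det (blocks A B C D)
  det-blocks-addLeft {a} {b} A B C D Y =
    trans (det-cong (≈M-sym added≈)) (det-+M-*M (blocks A B C D) X (not ∘ inRightBlock {a} {b}) support)
    where
    X : Matrix (a ℕ.+ b) (a ℕ.+ b)
    X = blocks 𝟎 𝟎 Y 𝟎
    support : ∀ l j → X l j ≈ 0# ⊎ (not (inRightBlock {a} {b} l) ≡ false × not (inRightBlock {a} {b} j) ≡ true)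
    support = ↑-elim {a} {b} _
      (λ l → ↑-elim {a} {b} _ (λ j → inj₁ (reflexive (blocks-↑ˡ-↑ˡ (𝟎 {a} {a}) 𝟎 Y 𝟎 l j)))
                      (λ j → inj₁ (reflexive (blocks-↑ˡ-↑ʳ (𝟎 {a} {a}) 𝟎 Y 𝟎 l j))))
      (λ l → ↑-elim {a} {b} _ (λ j → inj₂ (≡.cong not (inRightBlock-↑ʳ a l) , ≡.cong not (inRightBlock-↑ˡ b j)))
                      (λ j → inj₁ (reflexive (blocks-↑ʳ-↑ʳ (𝟎 {a} {a}) 𝟎 Y 𝟎 l j))))
    +M-dropZero : ∀ {r s k l} (W : Matrix r s) (P : Matrix r k) (Q : Matrix r l) {Y′} →
      (W +M ((P *M 𝟎) +M (Q *M Y′))) ≈M (W +M (Q *M Y′))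
    +M-dropZero W P Q i j = +-congˡ (trans (+-congʳ (*M-zeroʳ P i j)) (+-identityˡ _))
    added≈ : (blocks A B C D +M (blocks A B C D *M X)) ≈M blocks (A +M (B *M Y)) B (C +M (D *M Y)) D
    added≈ = ≈M-trans (λ i j → +-congˡ (blocks-*M A B C D 𝟎 𝟎 Y 𝟎 i j))
      (≈M-trans (blocks-+M A _ B _ C _ D _)
      (blocks-cong (+M-dropZero A A B) (+M-zeroProducts B A B) (+M-dropZero C C D) (+M-zeroProducts D C D)))

  det-blocks-schur : ∀ {a b} (A : Matrix a a) (B : Matrix a b) (C : Matrix b a) (D : Matrix b b) (Z : Matrix a b) →
    (A *M Z) ≈M B → det (blocks A B C D) ≈ det A * det (D -M (C *M Z))
  det-blocks-schur {a} A B C D Z AZ≈B = begin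
    det (blocks A B C D)                                        ≈⟨ det-blocks-addRight A B C D (-M Z) ⟨
    det (blocks A (B +M (A *M (-M Z))) C (D +M (C *M (-M Z))))  ≈⟨ det-cong (blocks-cong ≈M-refl B′≈𝟎 ≈M-refl D′≈) ⟩
    det (blocks A 𝟎 C (D -M (C *M Z)))                          ≈⟨ det-blocks-lowerTriangular a A C _ ⟩
    det A * det (D -M (C *M Z))                                 ∎
    where
    open ≈-Reasoning
    B′≈𝟎 : (B +M (A *M (-M Z))) ≈M 𝟎
    B′≈𝟎 i j = trans (+-congˡ (trans (*M-negʳ A Z i j) (-‿cong (AZ≈B i j)))) (-‿inverseʳ _)
    D′≈ : (D +M (C *M (-M Z))) ≈M (D -M (C *M Z))
    D′≈ i j = +-congˡ (*M-negʳ C Z i j)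

  det-blocks-negIdentity : ∀ {n} (A : Matrix n n) → det (blocks A (-M 𝐈 n) (𝐈 n) 𝟎) ≈ 1#
  det-blocks-negIdentity {n} A = begin
    det (blocks A (-M 𝐈 n) (𝐈 n) 𝟎)
      ≈⟨ det-cong (blocks-cong A≈ ≈M-refl 𝐈≈ ≈M-refl) ⟩
    det (blocks (𝐈 n +M ((-M 𝐈 n) *M (𝐈 n -M A))) (-M 𝐈 n) (𝐈 n +M (𝟎 *M (𝐈 n -M A))) 𝟎)
      ≈⟨ det-blocks-addLeft (𝐈 n) (-M 𝐈 n) (𝐈 n) 𝟎 (𝐈 n -M A) ⟩
    det (blocks (𝐈 n) (-M 𝐈 n) (𝐈 n) 𝟎)
      ≈⟨ det-blocks-addRight (𝐈 n) (-M 𝐈 n) (𝐈 n) 𝟎 (𝐈 n) ⟨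
    det (blocks (𝐈 n) ((-M 𝐈 n) +M (𝐈 n *M 𝐈 n)) (𝐈 n) (𝟎 +M (𝐈 n *M 𝐈 n)))
      ≈⟨ det-cong (blocks-cong ≈M-refl -𝐈+𝐈≈𝟎 ≈M-refl 𝟎+𝐈≈𝐈) ⟩
    det (blocks (𝐈 n) 𝟎 (𝐈 n) (𝐈 n))
      ≈⟨ det-blocks-lowerTriangular n (𝐈 n) (𝐈 n) (𝐈 n) ⟩
    det (𝐈 n) * det (𝐈 n)
      ≈⟨ trans (*-cong (det-𝐈 n) (det-𝐈 n)) (*-identityˡ 1#) ⟩
    1# ∎
    where
    open ≈-Reasoning
    A≈ : A ≈M (𝐈 n +M ((-M 𝐈 n) *M (𝐈 n -M A)))
    A≈ i j = sym (begin
      𝐈 n i j + ((-M 𝐈 n) *M (𝐈 n -M A)) i j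
        ≈⟨ +-congˡ (trans (*M-negˡ (𝐈 n) (𝐈 n -M A) i j) (-‿cong (*M-identityˡ (𝐈 n -M A) i j))) ⟩
      𝐈 n i j + - (𝐈 n i j - A i j)            ≈⟨ +-congˡ (sym (-‿+-comm _ _)) ⟩
      𝐈 n i j + (- 𝐈 n i j + - - A i j)        ≈⟨ sym (+-assoc _ _ _) ⟩
      𝐈 n i j - 𝐈 n i j + - - A i j            ≈⟨ +-cong (-‿inverseʳ _) (-‿involutive _) ⟩
      0# + A i j                               ≈⟨ +-identityˡ _ ⟩
      A i j                                    ∎)
    𝐈≈ : 𝐈 n ≈M (𝐈 n +M (𝟎 *M (𝐈 n -M A)))
    𝐈≈ i j = sym (trans (+-congˡ (*M-zeroˡ {n} (𝐈 n -M A) i j)) (+-identityʳ _))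
    -𝐈+𝐈≈𝟎 : ((-M 𝐈 n) +M (𝐈 n *M 𝐈 n)) ≈M 𝟎
    -𝐈+𝐈≈𝟎 i j = trans (+-congˡ (*M-identityˡ (𝐈 n) i j)) (-‿inverseˡ _)
    𝟎+𝐈≈𝐈 : (𝟎 +M (𝐈 n *M 𝐈 n)) ≈M 𝐈 n
    𝟎+𝐈≈𝐈 i j = trans (+-identityˡ _) (*M-identityˡ (𝐈 n) i j)

  det-*-rightInverse : ∀ {n} (A A⁻¹ : Matrix n n) → (A *M A⁻¹) ≈M 𝐈 n → det A * det A⁻¹ ≈ 1#
  det-*-rightInverse {n} A A⁻¹ AA⁻¹≈𝐈 = begin
    det A * det A⁻¹                            ≈⟨ *-congˡ (det-cong A⁻¹≈) ⟩
    det A * det (𝟎 -M (𝐈 n *M (-M A⁻¹)))      ≈⟨ det-blocks-schur A (-M 𝐈 n) (𝐈 n) 𝟎 (-M A⁻¹) A[-A⁻¹]≈-𝐈 ⟨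
    det (blocks A (-M 𝐈 n) (𝐈 n) 𝟎)           ≈⟨ det-blocks-negIdentity A ⟩
    1#                                         ∎
    where
    open ≈-Reasoning
    A[-A⁻¹]≈-𝐈 : (A *M (-M A⁻¹)) ≈M (-M 𝐈 n)
    A[-A⁻¹]≈-𝐈 i j = trans (*M-negʳ A A⁻¹ i j) (-‿cong (AA⁻¹≈𝐈 i j))
    A⁻¹≈ : A⁻¹ ≈M (𝟎 -M (𝐈 n *M (-M A⁻¹)))
    A⁻¹≈ i j = sym (trans (+-identityˡ _) (trans (-‿cong (*M-identityˡ (-M A⁻¹) i j)) (-‿involutive _)))

  -- Block inverses

  -- The inverse of [[D, P], [Q, K]] built from D⁻¹ and the inverse S⁻¹ of the Schur complement
  -- S = K − Q D⁻¹ P.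
  schurInverse : ∀ {a a′ b b′} → Matrix a′ a → Matrix a b′ → Matrix b a′ → Matrix b′ b →
    Matrix (a′ ℕ.+ b′) (a ℕ.+ b)
  schurInverse D⁻¹ P Q S⁻¹ =
    blocks (D⁻¹ +M ((D⁻¹ *M P) *M (S⁻¹ *M (Q *M D⁻¹)))) (-M ((D⁻¹ *M P) *M S⁻¹)) (-M (S⁻¹ *M (Q *M D⁻¹))) S⁻¹

  schurInverse-↑ˡ-↑ʳ : ∀ {a a′ b b′} (D⁻¹ : Matrix a′ a) (P : Matrix a b′) (Q : Matrix b a′) (S⁻¹ : Matrix b′ b)
    i j →
    schurInverse D⁻¹ P Q S⁻¹ (i ↑ˡ b′) (a ↑ʳ j) ≡ - ((D⁻¹ *M P) *M S⁻¹) i j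
  schurInverse-↑ˡ-↑ʳ D⁻¹ P Q S⁻¹ = blocks-↑ˡ-↑ʳ _ (-M ((D⁻¹ *M P) *M S⁻¹)) (-M (S⁻¹ *M (Q *M D⁻¹))) S⁻¹

  schurInverse-↑ʳ-↑ʳ : ∀ {a a′ b b′} (D⁻¹ : Matrix a′ a) (P : Matrix a b′) (Q : Matrix b a′) (S⁻¹ : Matrix b′ b)
    i j →
    schurInverse D⁻¹ P Q S⁻¹ (a′ ↑ʳ i) (a ↑ʳ j) ≡ S⁻¹ i j
  schurInverse-↑ʳ-↑ʳ D⁻¹ P Q S⁻¹ = blocks-↑ʳ-↑ʳ _ (-M ((D⁻¹ *M P) *M S⁻¹)) (-M (S⁻¹ *M (Q *M D⁻¹))) S⁻¹

  blocks-*M-schurInverse : ∀ {a a′ b b′} (D : Matrix a a′) (P : Matrix a b′) (Q : Matrix b a′) (K : Matrix b b′)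
    {D⁻¹ : Matrix a′ a} {S⁻¹ : Matrix b′ b} →
    (D *M D⁻¹) ≈M 𝐈 a → ((K -M (Q *M (D⁻¹ *M P))) *M S⁻¹) ≈M 𝐈 b →
    (blocks D P Q K *M schurInverse D⁻¹ P Q S⁻¹) ≈M 𝐈 (a ℕ.+ b)
  blocks-*M-schurInverse {a} {b = b} {b′} D P Q K {D⁻¹} {S⁻¹} DD⁻¹≈𝐈 SS⁻¹≈𝐈 =
    ≈M-trans (blocks-*M {m = a} D P Q K _ _ _ _)
      (≈M-trans (blocks-cong upperLeft upperRight lowerLeft lowerRight) (≈M-sym (𝐈-blocks a b)))
    where
    D⁻¹P = D⁻¹ *M P
    QD⁻¹ = Q *M D⁻¹
    S = K -M (Q *M D⁻¹P)
    D[D⁻¹P*Y]≈P*Y : ∀ {c} (Y : Matrix b′ c) → (D *M (D⁻¹P *M Y)) ≈M (P *M Y)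
    D[D⁻¹P*Y]≈P*Y Y = ≈M-trans (≈M-sym (*M-assoc D D⁻¹P Y)) (*M-congʳ Y (*M-cancelˡ {A = D} {D⁻¹} P DD⁻¹≈𝐈))
    KY-QD⁻¹PY≈SY : ∀ {c} (Y : Matrix b′ c) → ((K *M Y) -M (Q *M (D⁻¹P *M Y))) ≈M (S *M Y)
    KY-QD⁻¹PY≈SY Y i j =
      sym (trans (*M-distribʳ--M K (Q *M D⁻¹P) Y i j) (+-congˡ (-‿cong (*M-assoc Q D⁻¹P Y i j))))
    upperLeft : ((D *M (D⁻¹ +M (D⁻¹P *M (S⁻¹ *M QD⁻¹)))) +M (P *M (-M (S⁻¹ *M QD⁻¹)))) ≈M 𝐈 a
    upperLeft i j = trans
      (+-cong (trans (*M-distribˡ-+M D D⁻¹ (D⁻¹P *M (S⁻¹ *M QD⁻¹)) i j)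
                     (+-cong (DD⁻¹≈𝐈 i j) (D[D⁻¹P*Y]≈P*Y (S⁻¹ *M QD⁻¹) i j)))
              (*M-negʳ P (S⁻¹ *M QD⁻¹) i j))
      (x+y-y≈x _ _)
    upperRight : ((D *M (-M (D⁻¹P *M S⁻¹))) +M (P *M S⁻¹)) ≈M 𝟎
    upperRight i j =
      trans (+-congʳ (trans (*M-negʳ D (D⁻¹P *M S⁻¹) i j) (-‿cong (D[D⁻¹P*Y]≈P*Y S⁻¹ i j)))) (-‿inverseˡ _)
    lowerLeft : ((Q *M (D⁻¹ +M (D⁻¹P *M (S⁻¹ *M QD⁻¹)))) +M (K *M (-M (S⁻¹ *M QD⁻¹)))) ≈M 𝟎
    lowerLeft i j = trans (+-cong (*M-distribˡ-+M Q D⁻¹ (D⁻¹P *M (S⁻¹ *M QD⁻¹)) i j) (*M-negʳ K (S⁻¹ *M QD⁻¹) i j))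
                          (x+y-z≈0 (trans (KY-QD⁻¹PY≈SY (S⁻¹ *M QD⁻¹) i j) (*M-cancelˡ {A = S} {S⁻¹} QD⁻¹ SS⁻¹≈𝐈 i j)))
    lowerRight : ((Q *M (-M (D⁻¹P *M S⁻¹))) +M (K *M S⁻¹)) ≈M 𝐈 b
    lowerRight i j = trans (+-congʳ (*M-negʳ Q (D⁻¹P *M S⁻¹) i j))
                           (trans (+-comm _ _) (trans (KY-QD⁻¹PY≈SY S⁻¹ i j) (SS⁻¹≈𝐈 i j)))

  blocks-*M-flipInverse : ∀ {n m} (T : Matrix n m) →
    (blocks (-M T) (𝐈 n) (𝐈 m) 𝟎 *M blocks 𝟎 (𝐈 m) (𝐈 n) T) ≈M 𝐈 (n ℕ.+ m)
  blocks-*M-flipInverse {n} {m} T =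
    ≈M-trans (blocks-*M {m = n} (-M T) (𝐈 n) (𝐈 m) 𝟎 𝟎 (𝐈 m) (𝐈 n) T)
      (≈M-trans (blocks-cong upperLeft upperRight lowerLeft lowerRight) (≈M-sym (𝐈-blocks n m)))
    where
    upperLeft : (((-M T) *M 𝟎) +M (𝐈 n *M 𝐈 n)) ≈M 𝐈 n
    upperLeft i j = trans (+-cong (*M-zeroʳ (-M T) i j) (*M-identityˡ (𝐈 n) i j)) (+-identityˡ _)
    upperRight : (((-M T) *M 𝐈 m) +M (𝐈 n *M T)) ≈M 𝟎
    upperRight i j = trans (+-cong (*M-identityʳ (-M T) i j) (*M-identityˡ T i j)) (-‿inverseˡ _)
    lowerLeft : ((𝐈 m *M 𝟎) +M (𝟎 *M 𝐈 n)) ≈M 𝟎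
    lowerLeft i j = x≈0∧y≈0⇒x+y≈0 (*M-zeroʳ (𝐈 m) i j) (*M-zeroˡ (𝐈 n) i j)
    lowerRight : ((𝐈 m *M 𝐈 m) +M (𝟎 *M T)) ≈M 𝐈 m
    lowerRight i j = trans (+-cong (*M-identityˡ (𝐈 m) i j) (*M-zeroˡ T i j)) (+-identityʳ _)

  -- Inverting the construction

  -- Only a right inverse is carried; it suffices throughout.
  record Represents {n m} (C : Construction n m) (V : Matrix n m) : Set where
    field
      N⁻¹        : Matrix (Construction.size C) (Construction.size C)
      N*N⁻¹≈𝐈    : (Construction.N C *M N⁻¹) ≈M 𝐈 (Construction.size C)
      N⁻¹[I,J]≈V : ∀ i j → N⁻¹ (Construction.I C i) (Construction.J C j) ≈ V i j

  input-represents : ∀ {n m} (A : Matrix n m) → Represents (construct (input A)) A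
  input-represents {n} {m} A = record
    { N⁻¹        = schurInverse (𝐈 n) A 𝟎 (-M 𝐈 m)
    ; N*N⁻¹≈𝐈    = blocks-*M-schurInverse (𝐈 n) A 𝟎 (-M 𝐈 m) (*M-identityˡ (𝐈 n))
                     (≈M-trans (*M-congʳ (-M 𝐈 m) (-M-zeroʳ (-M 𝐈 m) (*M-zeroˡ (𝐈 n *M A)))) (-𝐈*-𝐈≈𝐈 m))
    ; N⁻¹[I,J]≈V = λ i j → trans (reflexive (schurInverse-↑ˡ-↑ʳ (𝐈 n) A 𝟎 (-M 𝐈 m) i j)) (begin
        - ((𝐈 n *M A) *M (-M 𝐈 m)) i j   ≈⟨ -‿cong (*M-negʳ (𝐈 n *M A) (𝐈 m) i j) ⟩
        - - ((𝐈 n *M A) *M 𝐈 m) i j     ≈⟨ -‿involutive _ ⟩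
        ((𝐈 n *M A) *M 𝐈 m) i j         ≈⟨ *M-identityʳ (𝐈 n *M A) i j ⟩
        (𝐈 n *M A) i j                  ≈⟨ *M-identityˡ A i j ⟩
        A i j                           ∎)
    }
    where open ≈-Reasoning

  inv-represents : ∀ {n} (f : Formula n n) {X V : Matrix n n} → Represents (construct f) X →
    (X *M V) ≈M 𝐈 n → Represents (construct (inv′ f)) V
  inv-represents {n} f {X} {V} rep XV≈𝐈 = record
    { N⁻¹        = schurInverse N′⁻¹ (-M colSel J′) (rowSel I′) V
    ; N*N⁻¹≈𝐈    = blocks-*M-schurInverse N′ (-M colSel J′) (rowSel I′) 𝟎 N′*N′⁻¹≈𝐈
                     (≈M-trans (*M-congʳ V schurComplement≈X) XV≈𝐈)
    ; N⁻¹[I,J]≈V = λ i j → reflexive (schurInverse-↑ʳ-↑ʳ N′⁻¹ (-M colSel J′) (rowSel I′) V i j)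
    }
    where
    open Construction (construct f) renaming (N to N′; I to I′; J to J′)
    open Represents rep renaming (N⁻¹ to N′⁻¹; N*N⁻¹≈𝐈 to N′*N′⁻¹≈𝐈)
    schurComplement≈X : (𝟎 -M (rowSel I′ *M (N′⁻¹ *M (-M colSel J′)))) ≈M X
    schurComplement≈X i j = begin
      0# - (rowSel I′ *M (N′⁻¹ *M (-M colSel J′))) i j  ≈⟨ +-identityˡ _ ⟩
      - (rowSel I′ *M (N′⁻¹ *M (-M colSel J′))) i j     ≈⟨ -‿cong (rowSel-*M I′ (N′⁻¹ *M (-M colSel J′)) i j) ⟩
      - (N′⁻¹ *M (-M colSel J′)) (I′ i) j               ≈⟨ -‿cong (*M-negʳ N′⁻¹ (colSel J′) (I′ i) j) ⟩
      - - (N′⁻¹ *M colSel J′) (I′ i) j                  ≈⟨ -‿involutive _ ⟩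
      (N′⁻¹ *M colSel J′) (I′ i) j                      ≈⟨ *M-colSel J′ N′⁻¹ (I′ i) j ⟩
      N′⁻¹ (I′ i) (J′ j)                                ≈⟨ N⁻¹[I,J]≈V i j ⟩
      X i j                                             ∎
      where open ≈-Reasoning

  mul-represents : ∀ {n k m} (f : Formula n k) (g : Formula k m) {X Y} →
    Represents (construct f) X → Represents (construct g) Y → Represents (construct (mul f g)) (X *M Y)
  mul-represents {k = k} f g {X} {Y} repL repR = record
    { N⁻¹        = schurInverse L⁻¹ (-M JI) 𝟎 R⁻¹
    ; N*N⁻¹≈𝐈    = blocks-*M-schurInverse L (-M JI) 𝟎 R LL⁻¹≈𝐈
                     (≈M-trans (*M-congʳ R⁻¹ (-M-zeroʳ R (*M-zeroˡ (L⁻¹ *M (-M JI))))) RR⁻¹≈𝐈)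
    ; N⁻¹[I,J]≈V = λ i j → trans (reflexive (schurInverse-↑ˡ-↑ʳ L⁻¹ (-M JI) 𝟎 R⁻¹ (IL i) (JR j))) (value i j)
    }
    where
    open Construction (construct f) renaming (N to L; I to IL; J to JL)
    open Construction (construct g) renaming (N to R; I to IR; J to JR)
    open Represents repL renaming (N⁻¹ to L⁻¹; N*N⁻¹≈𝐈 to LL⁻¹≈𝐈; N⁻¹[I,J]≈V to L⁻¹[I,J]≈X)
    open Represents repR renaming (N⁻¹ to R⁻¹; N*N⁻¹≈𝐈 to RR⁻¹≈𝐈; N⁻¹[I,J]≈V to R⁻¹[I,J]≈Y)
    JI = colSel JL *M rowSel IR
    value : ∀ i j → (-M ((L⁻¹ *M (-M JI)) *M R⁻¹)) (IL i) (JR j) ≈ (X *M Y) i j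
    value i j = begin
      - ((L⁻¹ *M (-M JI)) *M R⁻¹) (IL i) (JR j)
        ≈⟨ -‿cong (trans (*M-congʳ R⁻¹ (*M-negʳ L⁻¹ JI) (IL i) (JR j)) (*M-negˡ (L⁻¹ *M JI) R⁻¹ (IL i) (JR j))) ⟩
      - - ((L⁻¹ *M JI) *M R⁻¹) (IL i) (JR j)
        ≈⟨ -‿involutive _ ⟩
      ((L⁻¹ *M (colSel JL *M rowSel IR)) *M R⁻¹) (IL i) (JR j)
        ≈⟨ *M-congʳ R⁻¹ (≈M-sym (*M-assoc L⁻¹ (colSel JL) (rowSel IR))) (IL i) (JR j) ⟩
      (((L⁻¹ *M colSel JL) *M rowSel IR) *M R⁻¹) (IL i) (JR j)
        ≈⟨ *M-assoc (L⁻¹ *M colSel JL) (rowSel IR) R⁻¹ (IL i) (JR j) ⟩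
      ((L⁻¹ *M colSel JL) *M (rowSel IR *M R⁻¹)) (IL i) (JR j)
        ≈⟨ sumF-cong k (λ t → *-cong (trans (*M-colSel JL L⁻¹ (IL i) t) (L⁻¹[I,J]≈X i t))
                                     (trans (rowSel-*M IR R⁻¹ t (JR j)) (R⁻¹[I,J]≈Y t j))) ⟩
      (X *M Y) i j ∎
      where open ≈-Reasoning

  -- Up to the order of its columns (indexed by nL + (nR + (m + n)) instead of nL + (nR + (n + m)),
  -- hence the cast), N is [[L, P₁], [Q₁, [[R, P₂], [Q₂, K₂]]]].  Two Schur complement steps reduce
  -- its inversion to that of [[−T, 𝐈], [𝐈, 0]], and T is the required (I, J)-block X ± Y.
  module _ {n m} (sgn : Carrier → Carrier) (σ : Carrier) (sgn≈σ* : ∀ x → sgn x ≈ σ * x) (CL CR : Construction n m)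
           {X Y : Matrix n m} (repL : Represents CL X) (repR : Represents CR Y) where
    open Construction CL renaming (size to nL; N to L; I to IL; J to JL)
    open Construction CR renaming (size to nR; N to R; I to IR; J to JR)
    open Represents repL renaming (N⁻¹ to L⁻¹; N*N⁻¹≈𝐈 to LL⁻¹≈𝐈; N⁻¹[I,J]≈V to L⁻¹[I,J]≈X)
    open Represents repR renaming (N⁻¹ to R⁻¹; N*N⁻¹≈𝐈 to RR⁻¹≈𝐈; N⁻¹[I,J]≈V to R⁻¹[I,J]≈Y)

    private
      eq : nL ℕ.+ (nR ℕ.+ (m ℕ.+ n)) ≡ nL ℕ.+ (nR ℕ.+ (n ℕ.+ m))
      eq = ≡.cong (λ x → nL ℕ.+ (nR ℕ.+ x)) (ℕₚ.+-comm m n)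
      PL : Matrix nL m
      PL = colSel JL
      PR : Matrix nR m
      PR i j = sgn (colSel JR i j)
      QL : Matrix n nL
      QL = rowSel IL
      QR : Matrix n nR
      QR = rowSel IR
      N₀ : Matrix (nL ℕ.+ (nR ℕ.+ (n ℕ.+ m))) (nL ℕ.+ (nR ℕ.+ (m ℕ.+ n)))
      N₀ = vcat (hcat L (hcat (𝟎 {nL} {nR}) (hcat PL (𝟎 {nL} {n}))))
          (vcat (hcat (𝟎 {nR} {nL}) (hcat R (hcat PR (𝟎 {nR} {n}))))
          (vcat (hcat QL (hcat QR (hcat (𝟎 {n} {m}) (𝐈 n))))
                (hcat (𝟎 {m} {nL}) (hcat (𝟎 {m} {nR}) (hcat (𝐈 m) (𝟎 {m} {n}))))))
      P₁ : Matrix nL (nR ℕ.+ (m ℕ.+ n))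
      P₁ = hcat (𝟎 {nL} {nR}) (hcat PL (𝟎 {nL} {n}))
      Q₁ : Matrix (nR ℕ.+ (n ℕ.+ m)) nL
      Q₁ = vcat (𝟎 {nR} {nL}) (vcat QL (𝟎 {m} {nL}))
      P₂ : Matrix nR (m ℕ.+ n)
      P₂ = hcat PR (𝟎 {nR} {n})
      Q₂ : Matrix (n ℕ.+ m) nR
      Q₂ = vcat QR (𝟎 {m} {nR})
      K₂ : Matrix (n ℕ.+ m) (m ℕ.+ n)
      K₂ = blocks 𝟎 (𝐈 n) (𝐈 m) 𝟎
      N₀≈blocks : N₀ ≈M blocks L P₁ Q₁ (blocks R P₂ Q₂ K₂)
      N₀≈blocks = vcat-cong {nL} ≈M-refl (≈M-sym (≈M-trans
        (hcat-vcat-interchange 𝟎 (hcat R P₂) (vcat QL 𝟎) (hcat Q₂ K₂))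
        (vcat-cong {nR} ≈M-refl (≈M-trans
          (hcat-cong {c = nL} ≈M-refl (hcat-vcat-interchange QR (hcat 𝟎 (𝐈 n)) 𝟎 (hcat (𝐈 m) 𝟎)))
          (hcat-vcat-interchange QL (hcat QR (hcat 𝟎 (𝐈 n))) 𝟎 (hcat (𝟎 {m} {nR}) (hcat (𝐈 m) 𝟎)))))))
      TL TR T : Matrix n m
      TL = QL *M (L⁻¹ *M PL)
      TR = QR *M (R⁻¹ *M PR)
      T = TL +M TR
      S₂⁻¹ : Matrix (m ℕ.+ n) (n ℕ.+ m)
      S₂⁻¹ = blocks 𝟎 (𝐈 m) (𝐈 n) T
      S₁⁻¹ = schurInverse R⁻¹ P₂ Q₂ S₂⁻¹
      N₀⁻¹ = schurInverse L⁻¹ P₁ Q₁ S₁⁻¹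
      complement₁ : (blocks R P₂ Q₂ K₂ -M (Q₁ *M (L⁻¹ *M P₁))) ≈M blocks R P₂ Q₂ (blocks (-M TL) (𝐈 n) (𝐈 m) 𝟎)
      complement₁ = ≈M-trans (blocks--M-lowerRight R P₂ Q₂ K₂ (vcat QL 𝟎) L⁻¹ (hcat PL 𝟎))
        (blocks-cong {nR} {n ℕ.+ m} {nR} {m ℕ.+ n} ≈M-refl ≈M-refl ≈M-refl
          (≈M-trans (blocks--M-corner 𝟎 (𝐈 n) (𝐈 m) 𝟎 QL L⁻¹ PL)
            (blocks-cong {n} {m} {m} {n} (λ i j → +-identityˡ (- TL i j)) ≈M-refl ≈M-refl ≈M-refl)))
      complement₂ : (blocks (-M TL) (𝐈 n) (𝐈 m) 𝟎 -M (Q₂ *M (R⁻¹ *M P₂))) ≈M blocks (-M T) (𝐈 n) (𝐈 m) 𝟎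
      complement₂ = ≈M-trans (blocks--M-corner (-M TL) (𝐈 n) (𝐈 m) 𝟎 QR R⁻¹ PR)
        (blocks-cong {n} {m} {m} {n} (λ i j → -‿+-comm (TL i j) (TR i j)) ≈M-refl ≈M-refl ≈M-refl)
      N₀*N₀⁻¹≈𝐈 : (blocks L P₁ Q₁ (blocks R P₂ Q₂ K₂) *M N₀⁻¹) ≈M 𝐈 _
      N₀*N₀⁻¹≈𝐈 = blocks-*M-schurInverse L P₁ Q₁ (blocks R P₂ Q₂ K₂) LL⁻¹≈𝐈 (≈M-trans (*M-congʳ S₁⁻¹ complement₁)
        (blocks-*M-schurInverse R P₂ Q₂ (blocks (-M TL) (𝐈 n) (𝐈 m) 𝟎) RR⁻¹≈𝐈
          (≈M-trans (*M-congʳ S₂⁻¹ complement₂) (blocks-*M-flipInverse T))))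
      lookup : ∀ i j → N₀⁻¹ (cast (≡.sym eq) (cast eq (nL ↑ʳ (nR ↑ʳ (m ↑ʳ i))))) (nL ↑ʳ (nR ↑ʳ (n ↑ʳ j))) ≡ T i j
      lookup i j = ≡.trans (≡.cong (λ c → N₀⁻¹ c _) (Fin.cast-involutive (≡.sym eq) eq _))
        (≡.trans (schurInverse-↑ʳ-↑ʳ L⁻¹ P₁ Q₁ S₁⁻¹ _ _)
        (≡.trans (schurInverse-↑ʳ-↑ʳ R⁻¹ P₂ Q₂ S₂⁻¹ _ _) (blocks-↑ʳ-↑ʳ 𝟎 (𝐈 m) (𝐈 n) T i j)))
      T≈ : ∀ i j → T i j ≈ X i j + sgn (Y i j)
      T≈ i j = +-cong
        (trans (rowSel-*M IL (L⁻¹ *M PL) i j) (trans (*M-colSel JL L⁻¹ (IL i) j) (L⁻¹[I,J]≈X i j)))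
        (begin
          (QR *M (R⁻¹ *M PR)) i j                                  ≈⟨ rowSel-*M IR (R⁻¹ *M PR) i j ⟩
          sumF nR (λ l → R⁻¹ (IR i) l * sgn (colSel JR l j))      ≈⟨ sumF-cong nR (λ l → *-congˡ (sgn≈σ* _)) ⟩
          sumF nR (λ l → R⁻¹ (IR i) l * (σ * colSel JR l j))      ≈⟨ sumF-cong nR (λ l → x∙yz≈y∙xz _ _ _) ⟩
          sumF nR (λ l → σ * (R⁻¹ (IR i) l * colSel JR l j))      ≈⟨ *-distribˡ-sumF nR σ _ ⟨
          σ * (R⁻¹ *M colSel JR) (IR i) j
            ≈⟨ *-congˡ (trans (*M-colSel JR R⁻¹ (IR i) j) (R⁻¹[I,J]≈Y i j)) ⟩
          σ * Y i j                                               ≈⟨ sgn≈σ* (Y i j) ⟨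
          sgn (Y i j)                                             ∎)
        where open ≈-Reasoning

    addSub-represents : Represents (addSub sgn CL CR) (λ i j → X i j + sgn (Y i j))
    addSub-represents = record
      { N⁻¹        = λ c j → N₀⁻¹ (cast (≡.sym eq) c) j
      ; N*N⁻¹≈𝐈    = ≈M-trans (castCols-*M-castRows eq N₀ N₀⁻¹) (≈M-trans (*M-congʳ N₀⁻¹ N₀≈blocks) N₀*N₀⁻¹≈𝐈)
      ; N⁻¹[I,J]≈V = λ i j → trans (reflexive (lookup i j)) (T≈ i j)
      }

  construct-represents : ∀ {n m} (f : Formula n m) {V : Matrix n m} → Eval f V → Represents (construct f) V
  construct-represents (input A) (ev-input A)         = input-represents A
  construct-represents (inv′ f)  (ev-inv evf XV≈𝐈 _)  = inv-represents f (construct-represents f evf) XV≈𝐈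
  construct-represents (add f g) (ev-add evf evg)     =
    addSub-represents id 1# (sym ∘ *-identityˡ) (construct f) (construct g)
      (construct-represents f evf) (construct-represents g evg)
  construct-represents (sub f g) (ev-sub evf evg)     =
    addSub-represents -_ (- 1#) (sym ∘ -1*x≈-x) (construct f) (construct g)
      (construct-represents f evf) (construct-represents g evg)
  construct-represents (mul f g) (ev-mul evf evg)     =
    mul-represents f g (construct-represents f evf) (construct-represents g evg)

  module _ {n} {C : Construction n n} {V : Matrix n n} (rep : Represents C V) where
    open Construction C
    open Represents rep

    det-N≉0 : ¬ det N ≈ 0#
    det-N≉0 det-N≈0 = 0≉1 (begin
      0#                ≈⟨ zeroˡ (det N⁻¹) ⟨
      0# * det N⁻¹      ≈⟨ *-congʳ det-N≈0 ⟨
      det N * det N⁻¹   ≈⟨ det-*-rightInverse N N⁻¹ N*N⁻¹≈𝐈 ⟩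
      1#                ∎)
      where open ≈-Reasoning

    det-N̂≈det-N*det-V : det (N̂ C) ≈ det N * det V
    det-N̂≈det-N*det-V = begin
      det (N̂ C)                                               ≈⟨ det-blocks-schur N _ _ 𝟎 Z NZ≈-colSel ⟩
      det N * det (𝟎 -M (rowSel I *M Z))                      ≈⟨ *-congˡ (det-cong complement≈V) ⟩
      det N * det V                                           ∎
      where
      open ≈-Reasoning
      Z = N⁻¹ *M (-M colSel J)
      NZ≈-colSel : (N *M Z) ≈M (-M colSel J)
      NZ≈-colSel = *M-cancelˡ {A = N} {N⁻¹} (-M colSel J) N*N⁻¹≈𝐈
      complement≈V : (𝟎 -M (rowSel I *M Z)) ≈M V
      complement≈V i j = begin
        0# - (rowSel I *M Z) i j              ≈⟨ +-identityˡ _ ⟩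
        - (rowSel I *M Z) i j                 ≈⟨ -‿cong (trans (rowSel-*M I Z i j) (*M-negʳ N⁻¹ (colSel J) (I i) j)) ⟩
        - - (N⁻¹ *M colSel J) (I i) j         ≈⟨ -‿involutive _ ⟩
        (N⁻¹ *M colSel J) (I i) j             ≈⟨ *M-colSel J N⁻¹ (I i) j ⟩
        N⁻¹ (I i) (J j)                       ≈⟨ N⁻¹[I,J]≈V i j ⟩
        V i j                                 ∎

lemma4p3 : (ℝ : RealField) → let open Matrices ℝ in
    ∀ {n : ℕ} (f : Formula n n) (V : Matrix n n) → Eval f V →
    Σ (¬ (RealField._≈_ ℝ (det (Construction.N (construct f))) (RealField.0# ℝ)))
      (λ nz → RealField._≈_ ℝ (det V)
        (RealField._*_ ℝ (det (N̂ (construct f))) (RealField.inv ℝ (det (Construction.N (construct f))) nz)))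
lemma4p3 ℝ f V ev = det-N≉0 ℝ rep , (begin
  det V                                  ≈⟨ *-identityʳ (det V) ⟨
  det V * 1#                             ≈⟨ *-congˡ (inv-r (det N) (det-N≉0 ℝ rep)) ⟨
  det V * (det N * inv (det N) _)        ≈⟨ *-assoc (det V) (det N) _ ⟨
  det V * det N * inv (det N) _          ≈⟨ *-congʳ (trans (*-comm (det V) (det N)) (sym (det-N̂≈det-N*det-V ℝ rep))) ⟩
  det (N̂ (construct f)) * inv (det N) _  ∎)
  where
  open RealField ℝ
  open Matrices ℝ
  open import Relation.Binary.Reasoning.Setoid setoid
  rep = construct-represents ℝ f ev
  N = Construction.N (construct f)
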